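{- Let $r$ be an odd prime $\ell$, $q=p^n$ a prime power, $k=\frac{q^\ell-1}{q-1}$, and $0\le a,b\le q-2$. Then $(a,b)_{q-1}=\#T_\ell(a,b)+\ell\,\#I_\ell(a,b)$.
   Context: Fix a generator $\omega$ of $\mathbb{F}_{q^\ell}^\times$; $e=q-1$, $C_a:=\omega^a\langle\omega^e\rangle$, $(a,b)_e:=\#\{x\in C_a\mid x+1\in C_b\}$. $T_\ell(a,b):=\{x\in\mathbb{F}_q\mid x^\ell=\omega^{ak},\ (x+1)^\ell=\omega^{bk}\}$, and $I_\ell(a,b):=\{m_x(X)\in\mathbb{F}_q[X]\mid x\in\bar{\mathbb{F}}_q,\ [\mathbb{F}_q(x):\mathbb{F}_q]=\ell,\ m_x(0)=-\omega^{ak},\ m_x(-1)=-\omega^{bk}\}$, where $m_x$ is the minimal polynomial of $x$ over $\mathbb{F}_q$. -}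

module Defs where

open import Level using (0ℓ)
open import Data.Nat as ℕ using (ℕ; zero; suc; _<_)
open import Data.Product using (Σ; ∃; ∃-syntax; _×_; _,_)
open import Data.List using (List; length)
open import Data.List.Membership.Propositional using (_∈_)
open import Data.List.Relation.Unary.Unique.Propositional using (Unique)
open import Data.Vec using (Vec; []; _∷_)
open import Data.Vec.Relation.Unary.All using (All)
open import Function.Bundles using (_⇔_)
open import Relation.Binary.PropositionalEquality using (_≡_; _≢_)
open import Algebra.Structures using (IsCommutativeRing)

HasSize : {A : Set} → (A → Set) → ℕ → Set
HasSize {A} P n =
  Σ (List A) λ xs → Unique xs × (∀ x → (x ∈ xs) ⇔ P x) × (length xs ≡ n)

record Field : Set₁ where
  infixl 7 _*_
  infixl 6 _+_
  field
    Carrier : Set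
    _+_ _*_ : Carrier → Carrier → Carrier
    -_      : Carrier → Carrier
    0# 1#   : Carrier
    isCommutativeRing : IsCommutativeRing _≡_ _+_ _*_ -_ 0# 1#
    0≢1     : 0# ≢ 1#
    inverse : ∀ x → x ≢ 0# → ∃[ y ] (x * y ≡ 1#)

  infixr 8 _^_
  _^_ : Carrier → ℕ → Carrier
  x ^ zero  = 1#
  x ^ suc n = x * (x ^ n)

  eval : ∀ {d} → Vec Carrier d → Carrier → Carrier
  eval []       x = 0#
  eval (c ∷ cs) x = c + x * eval cs x

  -- the monic polynomial X^d + c_{d-1} X^{d-1} + … + c₀, evaluated at x
  evalMonic : ∀ {d} → Vec Carrier d → Carrier → Carrier
  evalMonic {d} c x = eval c x + x ^ d

record Subfield (K : Field) : Set₁ where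
  open Field K
  field
    In     : Carrier → Set
    In-0   : In 0#
    In-1   : In 1#
    In-+   : ∀ {x y} → In x → In y → In (x + y)
    In-*   : ∀ {x y} → In x → In y → In (x * y)
    In--   : ∀ {x} → In x → In (- x)
    In-inv : ∀ {x y} → In x → x * y ≡ 1# → In y

module _ {K : Field} (F : Subfield K) where
  open Field K
  open Subfield F

  IsMinPolyOfDegree : (d : ℕ) → Carrier → Vec Carrier d → Set
  IsMinPolyOfDegree d x c =
    All In c × evalMonic c x ≡ 0#
    × (∀ d′ → d′ < d → (c′ : Vec Carrier d′) → All In c′ → evalMonic c′ x ≢ 0#)

module Cyclotomy (K : Field) (F : Subfield K) (ω : Field.Carrier K)
                 (e k ℓ : ℕ) where
  open Field K
  open Subfield F

  InC : ℕ → Carrier → Set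
  InC a x = ∃[ j ] (x ≡ ω ^ a * (ω ^ e) ^ j)

  -- {x ∈ C_a | x + 1 ∈ C_b}; its size is the cyclotomic number (a,b)_e
  CycloSet : ℕ → ℕ → Carrier → Set
  CycloSet a b x = InC a x × InC b (x + 1#)

  TSet : ℕ → ℕ → Carrier → Set
  TSet a b x = In x × x ^ ℓ ≡ ω ^ (a ℕ.* k) × (x + 1#) ^ ℓ ≡ ω ^ (b ℕ.* k)

  -- I_ℓ(a,b): minimal polynomials m_x (monic, degree ℓ, given by their
  -- ℓ lower coefficients) of elements x of degree ℓ over F_q with
  -- m_x(0) = -ω^{ak}, m_x(-1) = -ω^{bk}
  ISet : ℕ → ℕ → Vec Carrier ℓ → Set
  ISet a b m = ∃[ x ] (IsMinPolyOfDegree F ℓ x m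
                       × evalMonic m 0# ≡ - (ω ^ (a ℕ.* k))
                       × evalMonic m (- 1#) ≡ - (ω ^ (b ℕ.* k)))

-- Let N(x) = x ^ k be the norm from K = F_{q^ℓ} to F = F_q.  Its kernel on K^× is ⟨ω ^ e⟩, so the
-- class C_a is the set of x with N(x) = ω ^ (a k), and (a,b)_e counts the x with N(x) = ω ^ (a k) and
-- N(x + 1) = ω ^ (b k).  If x ∈ F then N(x) = x ^ ℓ, and these x form T_ℓ(a,b).  Otherwise x has
-- degree ℓ, because ℓ is prime, and its minimal polynomial is m_x = ∏_{i<ℓ} (X - x ^ (q ^ i)); as
-- ℓ is odd, m_x(0) = -N(x) and m_x(-1) = -N(x + 1).  So x ↦ m_x maps the remaining x onto
-- I_ℓ(a,b), and its fibres are the conjugacy classes, each of size ℓ.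
--
-- The finite-field facts behind this are derived from the two cardinalities: Fermat's little
-- theorem from translating a finite set by a unit, q · 1 = 0 from translating F by 1, the
-- additivity of x ↦ x ^ q from the binomial theorem, and F = {x | x ^ q = x} because X ^ (q - 1) - 1
-- has at most q - 1 roots.

module Submission where

open import Defs
open import Algebra.Structures using (IsCommutativeMonoid)
open import Data.Nat as ℕ using (ℕ)
open import Data.Nat.Primality using (Prime)
open import Data.Product using (Σ)
open import Data.Unit using (⊤)
open import Relation.Binary.PropositionalEquality

module PrimeArithmetic where
  open import Data.Nat using (zero; suc; _+_; _*_; _∸_; _<_; _≤_; _!; NonZero; s≤s; nonTrivial⇒n>1)
  open import Data.Nat.Properties using (<-irrefl; <-≤-trans; n<1+n; <-trans; ∸-monoʳ-<; <⇒≤; _!*_!≢0)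
  open import Data.Nat.Combinatorics using (_C_; nCk≡n!/k![n-k]!; k![n∸k]!∣n!)
  open import Data.Nat.Divisibility using (_∣_; divides; ∣⇒≤; ∣1⇒≡1; m∣m*n)
  open import Data.Nat.DivMod using (_/_; _%_; m/n*n≡m; m%n<n; m≡m%n+[m/n]*n)
  open import Data.Nat.Primality using (Prime; euclidsLemma; prime⇒nonTrivial; prime⇒nonZero; prime⇒irreducible)
  open import Data.Empty using (⊥-elim)
  open import Data.Sum using (inj₁; inj₂)
  open import Relation.Nullary using (¬_)

  prime>1 : ∀ {p} → Prime p → 1 < p
  prime>1 {p} p-prime = nonTrivial⇒n>1 p {{prime⇒nonTrivial p-prime}}

  prime≢2⇒odd : ∀ {ℓ} → Prime ℓ → ℓ ≢ 2 → ℓ ≡ 1 + (ℓ / 2) * 2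
  prime≢2⇒odd {ℓ} ℓ-prime ℓ≢2 with ℓ % 2 | m%n<n ℓ 2 | m≡m%n+[m/n]*n ℓ 2
  ... | 1           | _            | ℓ≡1+[ℓ/2]*2 = ℓ≡1+[ℓ/2]*2
  ... | suc (suc _) | s≤s (s≤s ()) | _
  ... | 0           | _            | ℓ≡[ℓ/2]*2 with prime⇒irreducible ℓ-prime (divides (ℓ / 2) ℓ≡[ℓ/2]*2)
  ...   | inj₁ ()
  ...   | inj₂ 2≡ℓ = ⊥-elim (ℓ≢2 (sym 2≡ℓ))

  prime∤! : ∀ {p m} → Prime p → m < p → ¬ p ∣ m !
  prime∤! {m = zero}  p-prime _   p∣1  = <-irrefl (sym (∣1⇒≡1 p∣1)) (prime>1 p-prime)
  prime∤! {m = suc m} p-prime m<p p∣m! with euclidsLemma (suc m) (m !) p-prime p∣m!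
  ... | inj₁ p∣1+m = <-irrefl refl (<-≤-trans m<p (∣⇒≤ p∣1+m))
  ... | inj₂ p∣m!  = prime∤! p-prime (<-trans (n<1+n m) m<p) p∣m!

  n∣n! : ∀ n → .{{NonZero n}} → n ∣ n !
  n∣n! (suc n) = m∣m*n (n !)

  nCk*k![n∸k]!≡n! : ∀ {n k} → k ≤ n → (n C k) * (k ! * (n ∸ k) !) ≡ n !
  nCk*k![n∸k]!≡n! {n} {k} k≤n =
    trans (cong (_* (k ! * (n ∸ k) !)) (nCk≡n!/k![n-k]! k≤n)) (m/n*n≡m (k![n∸k]!∣n! k≤n))
    where instance _ = k !* (n ∸ k) !≢0

  prime∣pCk : ∀ {p k} → Prime p → 0 < k → k < p → p ∣ p C k
  prime∣pCk {p} {k} p-prime 0<k k<p with euclidsLemma (p C k) (k ! * (p ∸ k) !) p-prime p∣pCk*k![p∸k]!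
    where
    p∣pCk*k![p∸k]! : p ∣ (p C k) * (k ! * (p ∸ k) !)
    p∣pCk*k![p∸k]! = subst (p ∣_) (sym (nCk*k![n∸k]!≡n! (<⇒≤ k<p))) (n∣n! p {{prime⇒nonZero p-prime}})
  ... | inj₁ p∣pCk = p∣pCk
  ... | inj₂ p∣k![p∸k]! with euclidsLemma (k !) ((p ∸ k) !) p-prime p∣k![p∸k]!
  ...   | inj₁ p∣k!     = ⊥-elim (prime∤! p-prime k<p p∣k!)
  ...   | inj₂ p∣[p∸k]! = ⊥-elim (prime∤! p-prime (∸-monoʳ-< 0<k (<⇒≤ k<p)) p∣[p∸k]!)

module GeometricSeries where
  open import Data.Nat using (ℕ; zero; suc; _+_; _*_; _^_; _∸_; _<_; s≤s; z≤n)
  open import Data.Nat.Properties using (m∸n+n≡m; +-comm; *-mono-≤)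
  open import Data.Nat.Solver using (module +-*-Solver)
  open +-*-Solver using (solve; con; _:+_; _:*_; _:=_)
  open ≡-Reasoning

  geometric : ℕ → ℕ → ℕ
  geometric q zero    = 0
  geometric q (suc l) = 1 + q * geometric q l

  geometric-*-pred : ∀ {q} → 0 < q → ∀ l → geometric q l * (q ∸ 1) + 1 ≡ q ^ l
  geometric-*-pred 0<q zero    = refl
  geometric-*-pred {q} 0<q (suc l) = begin
    (1 + q * g) * e + 1       ≡⟨ cong (λ m → (1 + m * g) * e + 1) q≡1+e ⟩
    (1 + suc e * g) * e + 1   ≡⟨ solve 2 (λ e g → (con 1 :+ (con 1 :+ e) :* g) :* e :+ con 1
                                             := (con 1 :+ e) :* (g :* e :+ con 1)) refl e g ⟩
    suc e * (g * e + 1)       ≡⟨ cong₂ _*_ (sym q≡1+e) (geometric-*-pred 0<q l) ⟩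
    q * q ^ l                 ∎
    where
    e = q ∸ 1
    g = geometric q l
    q≡1+e : q ≡ suc e
    q≡1+e = trans (sym (m∸n+n≡m 0<q)) (+-comm e 1)

  1<geometric : ∀ {q l} → 0 < q → 1 < l → 1 < geometric q l
  1<geometric {l = suc zero}    _   (s≤s ())
  1<geometric {l = suc (suc l)} 0<q _          = s≤s (*-mono-≤ 0<q (s≤s z≤n))

module Counting {A : Set} where
  open import Data.Empty using (⊥-elim)
  open import Data.Fin using (_≟_)
  open import Data.List using (List; []; _∷_; length; filter; lookup; map)
  open import Data.List.Membership.Propositional using (_∈_)
  open import Data.List.Membership.Propositional.Properties using (∈-filter⁺; ∈-filter⁻; ∈-map⁺; ∈-map⁻)
  open import Data.List.Relation.Binary.Permutation.Propositional using (_↭_)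
  open import Data.List.Membership.Propositional.Properties.WithK using (unique∧set⇒bag)
  open import Data.List.Relation.Binary.BagAndSetEquality using (∼bag⇒↭)
  open import Data.List.Relation.Binary.Permutation.Propositional.Properties using (↭-length)
  open import Data.List.Relation.Unary.Any using (here; there; index)
  open import Data.List.Relation.Unary.Any.Properties using (lookup-index)
  open import Data.List.Relation.Unary.All as All using ()
  open import Data.List.Relation.Unary.AllPairs using (_∷_)
  open import Data.List.Relation.Unary.Unique.Propositional using (Unique)
  import Data.List.Relation.Unary.Unique.Propositional.Properties as Unique
  open import Data.Nat using (suc; _+_; _*_; _<_; s≤s; z≤n)
  open import Data.Nat.Properties using (+-suc)
  open import Data.Product using (_×_; _,_; proj₁; ∃-syntax)
  open import Function.Definitions using (Injective)
  open import Function.Bundles using (_⇔_; mk⇔; Equivalence)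
  import Function.Properties.Equivalence as ⇔
  open import Relation.Binary.Definitions using (DecidableEquality)
  open import Relation.Nullary using (yes; no)
  open import Relation.Unary using (Decidable; _∩_; ∁)
  open import Relation.Unary.Properties using (∁?)

  enumeration⇒≟ : (xs : List A) → (∀ x → x ∈ xs) → DecidableEquality A
  enumeration⇒≟ xs complete x y with index (complete x) ≟ index (complete y)
  ... | yes i≡j = yes (begin
    x                               ≡⟨ lookup-index (complete x) ⟩
    lookup xs (index (complete x))  ≡⟨ cong (lookup xs) i≡j ⟩
    lookup xs (index (complete y))  ≡⟨ lookup-index (complete y) ⟨
    y                               ∎)
    where open ≡-Reasoning
  ... | no i≢j = no λ { refl → i≢j refl }

  hasSize-unique : ∀ {P : A → Set} {m n} → HasSize P m → HasSize P n → m ≡ n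
  hasSize-unique (xs , xs! , xs⇔P , refl) (ys , ys! , ys⇔P , refl) =
    ↭-length (∼bag⇒↭ (unique∧set⇒bag xs! ys! λ {x} → ⇔.trans (xs⇔P x) (⇔.sym (ys⇔P x))))

  map-bijective-↭ : ∀ {f : A → A} {xs} → Unique xs → Injective _≡_ _≡_ f →
                    (∀ {x} → x ∈ xs → f x ∈ xs) → (∀ {y} → y ∈ xs → ∃[ x ] (x ∈ xs × f x ≡ y)) →
                    map f xs ↭ xs
  map-bijective-↭ {f} {xs} xs! f-injective into onto =
    ∼bag⇒↭ (unique∧set⇒bag (Unique.map⁺ f-injective xs!) xs! (mk⇔ to from))
    where
    to : ∀ {y} → y ∈ map f xs → y ∈ xs
    to y∈ with x , x∈xs , refl ← ∈-map⁻ f y∈ = into x∈xs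
    from : ∀ {y} → y ∈ xs → y ∈ map f xs
    from y∈xs with x , x∈xs , refl ← onto y∈xs = ∈-map⁺ f x∈xs

  hasSize-resp-⇔ : ∀ {P Q : A → Set} {n} → (∀ x → P x ⇔ Q x) → HasSize P n → HasSize Q n
  hasSize-resp-⇔ P⇔Q (xs , xs! , xs⇔P , |xs|) = xs , xs! , (λ x → ⇔.trans (xs⇔P x) (P⇔Q x)) , |xs|

  hasSize-∩ : ∀ {P Q : A → Set} {n} (Q? : Decidable Q) (P! : HasSize P n) →
              HasSize (P ∩ Q) (length (filter Q? (proj₁ P!)))
  hasSize-∩ {P} {Q} Q? (xs , xs! , xs⇔P , _) =
    filter Q? xs , Unique.filter⁺ Q? xs! , (λ x → mk⇔ to from) , refl
    where
    to : ∀ {x} → x ∈ filter Q? xs → (P ∩ Q) x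
    to x∈ with x∈xs , Qx ← ∈-filter⁻ Q? {xs = xs} x∈ = Equivalence.to (xs⇔P _) x∈xs , Qx
    from : ∀ {x} → (P ∩ Q) x → x ∈ filter Q? xs
    from (Px , Qx) = ∈-filter⁺ Q? (Equivalence.from (xs⇔P _) Px) Qx

  hasSize⇒0< : ∀ {P : A → Set} {n x} → HasSize P n → P x → 0 < n
  hasSize⇒0< ([] , _ , xs⇔P , _) Px with () ← Equivalence.from (xs⇔P _) Px
  hasSize⇒0< (_ ∷ _ , _ , _ , refl) _ = s≤s z≤n

  length-partition : ∀ {Q : A → Set} (Q? : Decidable Q) xs →
                     length xs ≡ length (filter Q? xs) + length (filter (∁? Q?) xs)
  length-partition Q? [] = refl
  length-partition Q? (x ∷ xs) with Q? x
  ... | yes _ = cong suc (length-partition Q? xs)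
  ... | no _  = trans (cong suc (length-partition Q? xs)) (sym (+-suc _ _))

  hasSize-partition : ∀ {P Q : A → Set} {n a b} (Q? : Decidable Q) →
                      HasSize P n → HasSize (P ∩ Q) a → HasSize (P ∩ ∁ Q) b → n ≡ a + b
  hasSize-partition Q? P!@(xs , _ , _ , refl) P∩Q! P∖Q! =
    trans (length-partition Q? xs)
          (cong₂ _+_ (hasSize-unique (hasSize-∩ Q? P!) P∩Q!) (hasSize-unique (hasSize-∩ (∁? Q?) P!) P∖Q!))

  hasSize-fibres : ∀ {B : Set} → DecidableEquality B → (f : A → B) →
                   ∀ {P : A → Set} {Q : B → Set} {m n L} → HasSize P m → HasSize Q n →
                   (∀ {x} → P x → Q (f x)) → (∀ {y} → Q y → HasSize (λ x → P x × f x ≡ y) L) →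
                   m ≡ n * L
  hasSize-fibres {B} _≟ᴮ_ f P! (ys , ys! , ys⇔Q , refl) into fibre =
    go ys ys! P! (λ Px → Equivalence.from (ys⇔Q _) (into Px)) (λ y∈ys → fibre (Equivalence.to (ys⇔Q _) y∈ys))
    where
    go : ∀ {P : A → Set} {m L} (ys : List B) → Unique ys → HasSize P m → (∀ {x} → P x → f x ∈ ys) →
         (∀ {y} → y ∈ ys → HasSize (λ x → P x × f x ≡ y) L) → m ≡ length ys * L
    go [] _ ([] , _ , _ , refl) _ _ = refl
    go [] _ (x ∷ _ , _ , x⇔P , _) into _ with () ← into (Equivalence.to (x⇔P x) (here refl))
    go {P} {L = L} (y ∷ ys) (y∉ys ∷ ys!) P! into fibre =
      trans (hasSize-partition fy? P! (fibre (here refl)) P∖fy!) (cong (L +_) (go ys ys! P∖fy! into′ fibre′))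
      where
      fy? : Decidable (λ x → f x ≡ y)
      fy? x = f x ≟ᴮ y
      P∖fy! = hasSize-∩ (∁? fy?) P!
      into′ : ∀ {x} → (P ∩ ∁ (λ x → f x ≡ y)) x → f x ∈ ys
      into′ (Px , fx≢y) with into Px
      ... | here fx≡y   = ⊥-elim (fx≢y fx≡y)
      ... | there fx∈ys = fx∈ys
      fibre′ : ∀ {y′} → y′ ∈ ys → HasSize (λ x → (P ∩ ∁ (λ x → f x ≡ y)) x × f x ≡ y′) L
      fibre′ {y′} y′∈ys = hasSize-resp-⇔ (λ x → mk⇔
        (λ (Px , fx≡y′) → (Px , λ fx≡y → All.lookup y∉ys y′∈ys (trans (sym fx≡y) fx≡y′)) , fx≡y′)
        (λ ((Px , _) , fx≡y′) → Px , fx≡y′)) (fibre (there y′∈ys))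

module CommutativeMonoidTranslation {A : Set} {_∙_ : A → A → A} {ε : A}
                                    (isCommutativeMonoid : IsCommutativeMonoid _≡_ _∙_ ε) where
  open import Algebra.Bundles using (CommutativeMonoid)
  open import Data.List using (List; []; _∷_; length; foldr; map)
  open import Data.List.Membership.Propositional using (_∈_)
  open import Data.List.Relation.Binary.Permutation.Propositional using (↭⇒↭ₛ)
  open import Data.List.Relation.Binary.Permutation.Setoid.Properties (setoid A) using (foldr-commMonoid)
  open import Data.List.Relation.Unary.Unique.Propositional using (Unique)
  open import Data.Product using (_×_; ∃-syntax)
  open import Function.Definitions using (Injective)

  open IsCommutativeMonoid isCommutativeMonoid using (identityˡ)

  commutativeMonoid : CommutativeMonoid _ _
  commutativeMonoid = record { isCommutativeMonoid = isCommutativeMonoid }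

  open import Algebra.Definitions.RawMonoid (CommutativeMonoid.rawMonoid commutativeMonoid) public
    using () renaming (_×_ to _·_)
  open import Algebra.Properties.CommutativeSemigroup (CommutativeMonoid.commutativeSemigroup commutativeMonoid)
    using (interchange)
  open Counting using (map-bijective-↭)

  fold : List A → A
  fold = foldr _∙_ ε

  fold-map-translate : ∀ g xs → fold (map (g ∙_) xs) ≡ (length xs · g) ∙ fold xs
  fold-map-translate g [] = sym (identityˡ ε)
  fold-map-translate g (x ∷ xs) =
    trans (cong ((g ∙ x) ∙_) (fold-map-translate g xs)) (interchange g x _ (fold xs))

  fold-translate-invariant : ∀ {g xs} → Unique xs → Injective _≡_ _≡_ (g ∙_) →
                             (∀ {x} → x ∈ xs → g ∙ x ∈ xs) →
                             (∀ {y} → y ∈ xs → ∃[ x ] (x ∈ xs × g ∙ x ≡ y)) →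
                             (length xs · g) ∙ fold xs ≡ fold xs
  fold-translate-invariant {g} {xs} xs! g∙-injective into onto =
    trans (sym (fold-map-translate g xs))
          (foldr-commMonoid isCommutativeMonoid (↭⇒↭ₛ (map-bijective-↭ xs! g∙-injective into onto)))

module FieldAlgebra (K : Field) where
  open import Algebra.Bundles using (CommutativeRing)
  open import Data.Nat as ℕ using (ℕ; zero; suc)
  import Data.Nat.DivMod as DivMod
  import Data.Nat.Properties as ℕ
  open import Data.Product using (_,_)
  open Field K public

  commutativeRing : CommutativeRing _ _
  commutativeRing = record { isCommutativeRing = isCommutativeRing }

  open CommutativeRing commutativeRing public
    using ( +-assoc; +-comm; +-identityˡ; +-identityʳ; -‿inverseˡ; -‿inverseʳ
          ; *-assoc; *-comm; *-identityˡ; *-identityʳ; zeroˡ; zeroʳ; distribʳ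
          ; +-group; +-abelianGroup; ring; semiring; commutativeSemiring
          ; +-isCommutativeMonoid; *-isCommutativeMonoid )
  open import Algebra.Properties.Ring ring public using (-‿involutive; -‿injective; -1*x≈-x; -0#≈0#)
  open import Algebra.Properties.Group +-group public using (∙-cancelˡ; ∙-cancelʳ; x∙y⁻¹≈ε⇒x≈y)
  open import Algebra.Properties.AbelianGroup +-abelianGroup public using (⁻¹-∙-comm)
  open import Algebra.Solver.Ring.NaturalCoefficients.Default commutativeSemiring public
    using (solve; _:+_; _:*_; _:=_)
  open import Algebra.Properties.Semiring.Mult semiring public
    using (×1-homo-*; ×-assoc-*; ×-homo-1) renaming (_×_ to _·_)
  open ≡-Reasoning

  ^-distribˡ-+-* : ∀ x m n → x ^ (m ℕ.+ n) ≡ x ^ m * x ^ n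
  ^-distribˡ-+-* x zero    n = sym (*-identityˡ _)
  ^-distribˡ-+-* x (suc m) n = trans (cong (x *_) (^-distribˡ-+-* x m n)) (sym (*-assoc _ _ _))

  ^-*-assoc : ∀ x m n → (x ^ m) ^ n ≡ x ^ (m ℕ.* n)
  ^-*-assoc x m zero    = cong (x ^_) (sym (ℕ.*-zeroʳ m))
  ^-*-assoc x m (suc n) = begin
    x ^ m * (x ^ m) ^ n      ≡⟨ cong (x ^ m *_) (^-*-assoc x m n) ⟩
    x ^ m * x ^ (m ℕ.* n)    ≡⟨ ^-distribˡ-+-* x m (m ℕ.* n) ⟨
    x ^ (m ℕ.+ m ℕ.* n)      ≡⟨ cong (x ^_) (ℕ.*-suc m n) ⟨
    x ^ (m ℕ.* suc n)        ∎

  ^-divMod : ∀ x s m .{{_ : ℕ.NonZero m}} → x ^ s ≡ x ^ (s ℕ.% m) * (x ^ m) ^ (s ℕ./ m)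
  ^-divMod x s m = begin
    x ^ s                             ≡⟨ cong (x ^_) (DivMod.m≡m%n+[m/n]*n s m) ⟩
    x ^ (r ℕ.+ t ℕ.* m)               ≡⟨ ^-distribˡ-+-* x r (t ℕ.* m) ⟩
    x ^ r * x ^ (t ℕ.* m)             ≡⟨ cong (λ i → x ^ r * x ^ i) (ℕ.*-comm t m) ⟩
    x ^ r * x ^ (m ℕ.* t)             ≡⟨ cong (x ^ r *_) (^-*-assoc x m t) ⟨
    x ^ r * (x ^ m) ^ t               ∎
    where
    r = s ℕ.% m
    t = s ℕ./ m

  ^-comm : ∀ x m n → (x ^ m) ^ n ≡ (x ^ n) ^ m
  ^-comm x m n = trans (^-*-assoc x m n) (trans (cong (x ^_) (ℕ.*-comm m n)) (sym (^-*-assoc x n m)))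

  ^-distribʳ-* : ∀ x y n → (x * y) ^ n ≡ x ^ n * y ^ n
  ^-distribʳ-* x y zero    = sym (*-identityˡ 1#)
  ^-distribʳ-* x y (suc n) = begin
    (x * y) * (x * y) ^ n      ≡⟨ cong ((x * y) *_) (^-distribʳ-* x y n) ⟩
    (x * y) * (x ^ n * y ^ n)  ≡⟨ solve 4 (λ x y a b → (x :* y) :* (a :* b) := (x :* a) :* (y :* b))
                                        refl x y (x ^ n) (y ^ n) ⟩
    (x * x ^ n) * (y * y ^ n)  ∎

  ^-zeroˡ : ∀ n → 1# ^ n ≡ 1#
  ^-zeroˡ zero    = refl
  ^-zeroˡ (suc n) = trans (*-identityˡ _) (^-zeroˡ n)

  ^-identityʳ : ∀ x → x ^ 1 ≡ x
  ^-identityʳ = *-identityʳ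

  0^m≡0 : ∀ {m} → 0 ℕ.< m → 0# ^ m ≡ 0#
  0^m≡0 {suc m} _ = zeroˡ (0# ^ m)

  -1^-odd : ∀ m → (- 1#) ^ (1 ℕ.+ m ℕ.* 2) ≡ - 1#
  -1^-odd zero    = *-identityʳ (- 1#)
  -1^-odd (suc m) = begin
    - 1# * (- 1# * (- 1#) ^ (1 ℕ.+ m ℕ.* 2))   ≡⟨ cong (λ x → - 1# * (- 1# * x)) (-1^-odd m) ⟩
    - 1# * (- 1# * - 1#)                       ≡⟨ cong (- 1# *_) (-1*x≈-x (- 1#)) ⟩
    - 1# * - (- 1#)                            ≡⟨ cong (- 1# *_) (-‿involutive 1#) ⟩
    - 1# * 1#                                  ≡⟨ *-identityʳ (- 1#) ⟩
    - 1#                                       ∎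

  *-cancelˡ : ∀ {a b c} → a ≢ 0# → a * b ≡ a * c → b ≡ c
  *-cancelˡ {a} {b} {c} a≢0 ab≡ac with a⁻¹ , aa⁻¹≡1 ← inverse a a≢0 =
    trans (sym (undo b)) (trans (cong (a⁻¹ *_) ab≡ac) (undo c))
    where
    undo : ∀ x → a⁻¹ * (a * x) ≡ x
    undo x = begin
      a⁻¹ * (a * x)   ≡⟨ solve 3 (λ a a⁻¹ x → a⁻¹ :* (a :* x) := (a :* a⁻¹) :* x) refl a a⁻¹ x ⟩
      (a * a⁻¹) * x   ≡⟨ cong (_* x) aa⁻¹≡1 ⟩
      1# * x          ≡⟨ *-identityˡ x ⟩
      x               ∎

  *-nonZero : ∀ {a b} → a ≢ 0# → b ≢ 0# → a * b ≢ 0#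
  *-nonZero a≢0 b≢0 ab≡0 = b≢0 (*-cancelˡ a≢0 (trans ab≡0 (sym (zeroʳ _))))

  ^-nonZero : ∀ {a} n → a ≢ 0# → a ^ n ≢ 0#
  ^-nonZero zero    a≢0 1≡0 = 0≢1 (sym 1≡0)
  ^-nonZero (suc n) a≢0     = *-nonZero a≢0 (^-nonZero n a≢0)

  x-y≡0⇒x≡y : ∀ {x y} → x + - y ≡ 0# → x ≡ y
  x-y≡0⇒x≡y = x∙y⁻¹≈ε⇒x≈y _ _

module FieldTranslation (K : Field) where
  open FieldAlgebra K
  open import Data.List.Membership.Propositional using (_∈_)
  open import Data.List.Relation.Unary.All using (All; []; _∷_)
  import Data.List.Relation.Unary.All as All
  open import Data.Nat using (zero; suc)
  open import Data.Product using (_,_; _×_; ∃-syntax)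
  open import Function.Bundles using (Equivalence)
  module Mul = CommutativeMonoidTranslation *-isCommutativeMonoid
  module Add = CommutativeMonoidTranslation +-isCommutativeMonoid
  open ≡-Reasoning

  private
    ·≡^ : ∀ n g → n Mul.· g ≡ g ^ n
    ·≡^ zero    g = refl
    ·≡^ (suc n) g = cong (g *_) (·≡^ n g)

    product-nonZero : ∀ {xs} → All (_≢ 0#) xs → Mul.fold xs ≢ 0#
    product-nonZero []             1≡0 = 0≢1 (sym 1≡0)
    product-nonZero (x≢0 ∷ xs≢0) = *-nonZero x≢0 (product-nonZero xs≢0)

  ^-size≡1 : ∀ {P : Carrier → Set} {n g h} → HasSize P n → (∀ {x} → P x → x ≢ 0#) →
             (∀ {x} → P x → P (g * x)) → (∀ {x} → P x → P (h * x)) → g * h ≡ 1# → g ^ n ≡ 1#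
  ^-size≡1 {P} {n} {g} {h} (xs , xs! , xs⇔P , refl) nonZero g-closed h-closed gh≡1 =
    *-cancelˡ Πxs≢0 (begin
      Mul.fold xs * g ^ n          ≡⟨ *-comm _ _ ⟩
      g ^ n * Mul.fold xs          ≡⟨ cong (_* Mul.fold xs) (·≡^ n g) ⟨
      n Mul.· g * Mul.fold xs      ≡⟨ Mul.fold-translate-invariant xs! (*-cancelˡ g≢0) into onto ⟩
      Mul.fold xs                  ≡⟨ *-identityʳ _ ⟨
      Mul.fold xs * 1#             ∎)
    where
    open Equivalence
    g≢0 : g ≢ 0#
    g≢0 g≡0 = 0≢1 (trans (sym (zeroˡ h)) (trans (cong (_* h) (sym g≡0)) gh≡1))
    Πxs≢0 : Mul.fold xs ≢ 0#
    Πxs≢0 = product-nonZero (All.tabulate (λ x∈xs → nonZero (to (xs⇔P _) x∈xs)))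
    into : ∀ {x} → x ∈ xs → g * x ∈ xs
    into x∈xs = from (xs⇔P _) (g-closed (to (xs⇔P _) x∈xs))
    onto : ∀ {y} → y ∈ xs → ∃[ x ] (x ∈ xs × g * x ≡ y)
    onto {y} y∈xs = h * y , from (xs⇔P _) (h-closed (to (xs⇔P _) y∈xs)) , (begin
      g * (h * y)   ≡⟨ *-assoc g h y ⟨
      (g * h) * y   ≡⟨ cong (_* y) gh≡1 ⟩
      1# * y        ≡⟨ *-identityˡ y ⟩
      y             ∎)

  ·-size≡0 : ∀ {P : Carrier → Set} {n g} → HasSize P n →
             (∀ {x} → P x → P (g + x)) → (∀ {x} → P x → P (- g + x)) → n · g ≡ 0#
  ·-size≡0 {P} {n} {g} (xs , xs! , xs⇔P , refl) g-closed -g-closed =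
    ∙-cancelʳ (Add.fold xs) _ _ (begin
      n · g + Add.fold xs   ≡⟨ Add.fold-translate-invariant xs! (∙-cancelˡ g _ _) into onto ⟩
      Add.fold xs           ≡⟨ +-identityˡ _ ⟨
      0# + Add.fold xs      ∎)
    where
    open Equivalence
    into : ∀ {x} → x ∈ xs → g + x ∈ xs
    into x∈xs = from (xs⇔P _) (g-closed (to (xs⇔P _) x∈xs))
    onto : ∀ {y} → y ∈ xs → ∃[ x ] (x ∈ xs × g + x ≡ y)
    onto {y} y∈xs = - g + y , from (xs⇔P _) (-g-closed (to (xs⇔P _) y∈xs)) , (begin
      g + (- g + y)   ≡⟨ +-assoc g (- g) y ⟨
      (g + - g) + y   ≡⟨ cong (_+ y) (-‿inverseʳ g) ⟩
      0# + y          ≡⟨ +-identityˡ y ⟩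
      y               ∎)

module Frobenius (K : Field) {p : ℕ} (p-prime : Prime p) where
  open FieldAlgebra K
  open PrimeArithmetic using (prime>1; prime∣pCk)
  open import Algebra.Properties.CommutativeSemiring.Binomial commutativeSemiring
    using (theorem; binomialTerm)
  open import Algebra.Properties.Semiring.Exp semiring
    using () renaming (_^_ to _^ₛ_)
  open import Algebra.Properties.Semiring.Sum semiring
    using (sum; sum-cong-≗; sum-init-last; sum-replicate-zero)
  open import Data.Fin as Fin using (Fin; fromℕ; inject₁)
  import Data.Fin.Properties as Fin
  open import Data.Nat as ℕ using (ℕ; zero; suc; s≤s; z≤n)
  import Data.Nat.Properties as ℕ
  open import Data.Nat.Combinatorics using (_C_; nCn≡1)
  open import Data.Nat.Divisibility using (_∣_; divides)
  open import Data.Vec.Functional using (init)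
  open import Function.Base using (_∘_)
  open ≡-Reasoning

  ^≡^ₛ : ∀ x n → x ^ n ≡ x ^ₛ n
  ^≡^ₛ x zero    = refl
  ^≡^ₛ x (suc n) = cong (x *_) (^≡^ₛ x n)

  sum-ends : ∀ {n} (t : Fin (suc (suc n)) → Carrier) → (∀ i → t (Fin.suc (inject₁ i)) ≡ 0#) →
             sum t ≡ t Fin.zero + t (fromℕ (suc n))
  sum-ends {n} t middle = begin
    t₀ + sum (t ∘ Fin.suc)                ≡⟨ cong (t₀ +_) (sum-init-last (t ∘ Fin.suc)) ⟩
    t₀ + (sum (init (t ∘ Fin.suc)) + tₗ)  ≡⟨ cong (λ s → t₀ + (s + tₗ)) middle≡0 ⟩
    t₀ + (0# + tₗ)                        ≡⟨ cong (t₀ +_) (+-identityˡ tₗ) ⟩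
    t₀ + tₗ                               ∎
    where
    t₀ = t Fin.zero
    tₗ = t (fromℕ (suc n))
    middle≡0 : sum (init (t ∘ Fin.suc)) ≡ 0#
    middle≡0 = trans (sum-cong-≗ middle) (sum-replicate-zero n)

  freshman : ∀ {m} x y → 0 ℕ.< m → (∀ {k} z → 0 ℕ.< k → k ℕ.< m → (m C k) · z ≡ 0#) →
             (x + y) ^ m ≡ x ^ m + y ^ m
  freshman {suc n} x y _ vanish = begin
    (x + y) ^ suc n                  ≡⟨ ^≡^ₛ (x + y) (suc n) ⟩
    (x + y) ^ₛ suc n                 ≡⟨ theorem (suc n) x y ⟩
    sum (binomialTerm x y (suc n))   ≡⟨ sum-ends (binomialTerm x y (suc n)) middle ⟩
    t Fin.zero + t (fromℕ (suc n))   ≡⟨ cong₂ _+_ first last ⟩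
    y ^ suc n + x ^ suc n            ≡⟨ +-comm _ _ ⟩
    x ^ suc n + y ^ suc n            ∎
    where
    m = suc n
    t = binomialTerm x y m
    first : t Fin.zero ≡ y ^ m
    first = begin
      1 · (1# * y ^ₛ m)   ≡⟨ ×-homo-1 _ ⟩
      1# * y ^ₛ m         ≡⟨ *-identityˡ _ ⟩
      y ^ₛ m              ≡⟨ ^≡^ₛ y m ⟨
      y ^ m               ∎
    last : t (fromℕ m) ≡ x ^ m
    last = begin
      t (fromℕ m)
        ≡⟨ cong (λ k → (m C k) · (x ^ₛ k * y ^ₛ (m ℕ.∸ k))) (Fin.toℕ-fromℕ m) ⟩
      (m C m) · (x ^ₛ m * y ^ₛ (m ℕ.∸ m))
        ≡⟨ cong₂ (λ c k → c · (x ^ₛ m * y ^ₛ k)) (nCn≡1 m) (ℕ.n∸n≡0 m) ⟩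
      1 · (x ^ₛ m * 1#)  ≡⟨ ×-homo-1 _ ⟩
      x ^ₛ m * 1#        ≡⟨ *-identityʳ _ ⟩
      x ^ₛ m             ≡⟨ ^≡^ₛ x m ⟨
      x ^ m              ∎
    middle : ∀ i → t (Fin.suc (inject₁ i)) ≡ 0#
    middle i = vanish _ (s≤s z≤n) (s≤s (subst (ℕ._< n) (sym (Fin.toℕ-inject₁ i)) (Fin.toℕ<n i)))

  module _ (p·1≡0 : p · 1# ≡ 0#) where

    p∣m⇒m·x≡0 : ∀ {m} x → p ∣ m → m · x ≡ 0#
    p∣m⇒m·x≡0 x (divides c refl) = begin
      (c ℕ.* p) · x                ≡⟨ cong ((c ℕ.* p) ·_) (*-identityˡ x) ⟨
      (c ℕ.* p) · (1# * x)         ≡⟨ ×-assoc-* (c ℕ.* p) 1# x ⟨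
      ((c ℕ.* p) · 1#) * x         ≡⟨ cong (_* x) (×1-homo-* c p) ⟩
      ((c · 1#) * (p · 1#)) * x    ≡⟨ cong (λ z → ((c · 1#) * z) * x) p·1≡0 ⟩
      ((c · 1#) * 0#) * x          ≡⟨ cong (_* x) (zeroʳ _) ⟩
      0# * x                       ≡⟨ zeroˡ x ⟩
      0#                           ∎

    frobenius : ∀ x y → (x + y) ^ p ≡ x ^ p + y ^ p
    frobenius x y = freshman x y (ℕ.<-trans (s≤s z≤n) (prime>1 p-prime))
      (λ z 0<k k<p → p∣m⇒m·x≡0 z (prime∣pCk p-prime 0<k k<p))

    frobenius-^ : ∀ m x y → (x + y) ^ (p ℕ.^ m) ≡ x ^ (p ℕ.^ m) + y ^ (p ℕ.^ m)
    frobenius-^ zero    x y = trans (^-identityʳ (x + y)) (sym (cong₂ _+_ (^-identityʳ x) (^-identityʳ y)))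
    frobenius-^ (suc m) x y = begin
      (x + y) ^ (p ℕ.* pᵐ)             ≡⟨ ^-*-assoc (x + y) p pᵐ ⟨
      ((x + y) ^ p) ^ pᵐ               ≡⟨ cong (_^ pᵐ) (frobenius x y) ⟩
      (x ^ p + y ^ p) ^ pᵐ             ≡⟨ frobenius-^ m (x ^ p) (y ^ p) ⟩
      (x ^ p) ^ pᵐ + (y ^ p) ^ pᵐ      ≡⟨ cong₂ _+_ (^-*-assoc x p pᵐ) (^-*-assoc y p pᵐ) ⟩
      x ^ (p ℕ.* pᵐ) + y ^ (p ℕ.* pᵐ)  ∎
      where
      pᵐ = p ℕ.^ m

module MonicPolynomial (K : Field) where
  open FieldAlgebra K
  open import Algebra.Solver.Ring.NaturalCoefficients.Default commutativeSemiring using (con)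
  open import Data.Empty using (⊥-elim)
  open import Data.List using (List; []; _∷_; length; foldr; map)
  open import Data.List.Membership.Propositional using (_∈_)
  open import Data.List.Relation.Unary.Any using (here; there)
  open import Data.List.Relation.Unary.All as All using (All; []; _∷_)
  open import Data.List.Relation.Unary.AllPairs using (_∷_)
  open import Data.List.Relation.Unary.Unique.Propositional using (Unique)
  open import Data.Nat as ℕ using (ℕ; zero; suc; _≤_; z≤n; s≤s)
  open import Data.Product using (_×_; _,_)
  open import Data.Vec as Vec using (Vec; []; _∷_; replicate; toList)
  open import Function.Base using (_∘_)
  open import Relation.Binary.Definitions using (DecidableEquality)
  open import Relation.Nullary using (yes; no)
  open ≡-Reasoning

  product : List Carrier → Carrier
  product = foldr _*_ 1#

  IsRoot : ∀ {d} → Vec Carrier d → Carrier → Set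
  IsRoot c r = evalMonic c r ≡ 0#

  evalMonic-[] : ∀ y → evalMonic [] y ≡ 1#
  evalMonic-[] y = +-identityˡ 1#

  evalMonic-∷ : ∀ {d} c (cs : Vec Carrier d) y → evalMonic (c ∷ cs) y ≡ c + y * evalMonic cs y
  evalMonic-∷ {d} c cs y =
    solve 4 (λ c y e t → (c :+ y :* e) :+ y :* t := c :+ y :* (e :+ t)) refl c y (eval cs y) (y ^ d)

  addConstant : ∀ {d} → Carrier → Vec Carrier (suc d) → Vec Carrier (suc d)
  addConstant a (c ∷ cs) = a + c ∷ cs

  addConstant-zero : ∀ {d} (c : Vec Carrier (suc d)) → addConstant 0# c ≡ c
  addConstant-zero (c ∷ cs) = cong (_∷ cs) (+-identityˡ c)

  evalMonic-addConstant : ∀ {d} a (c : Vec Carrier (suc d)) y →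
                          evalMonic (addConstant a c) y ≡ a + evalMonic c y
  evalMonic-addConstant a (c ∷ cs) y = begin
    evalMonic (a + c ∷ cs) y          ≡⟨ evalMonic-∷ (a + c) cs y ⟩
    (a + c) + y * evalMonic cs y      ≡⟨ +-assoc a c _ ⟩
    a + (c + y * evalMonic cs y)      ≡⟨ cong (a +_) (evalMonic-∷ c cs y) ⟨
    a + evalMonic (c ∷ cs) y          ∎

  mulLinear : ∀ {d} → Carrier → Vec Carrier d → Vec Carrier (suc d)
  mulLinear s []       = s ∷ []
  mulLinear s (c ∷ cs) = s * c ∷ addConstant c (mulLinear s cs)

  evalMonic-mulLinear : ∀ {d} s (c : Vec Carrier d) y →
                        evalMonic (mulLinear s c) y ≡ (y + s) * evalMonic c y
  evalMonic-mulLinear s [] y = begin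
    evalMonic (s ∷ []) y          ≡⟨ evalMonic-∷ s [] y ⟩
    s + y * evalMonic [] y        ≡⟨ cong (λ m → s + y * m) (evalMonic-[] y) ⟩
    s + y * 1#                    ≡⟨ solve 2 (λ s y → s :+ y :* con 1 := (y :+ s) :* con 1) refl s y ⟩
    (y + s) * 1#                  ≡⟨ cong ((y + s) *_) (evalMonic-[] y) ⟨
    (y + s) * evalMonic [] y      ∎
  evalMonic-mulLinear s (c ∷ cs) y = begin
    evalMonic (s * c ∷ addConstant c (mulLinear s cs)) y
      ≡⟨ evalMonic-∷ (s * c) (addConstant c (mulLinear s cs)) y ⟩
    s * c + y * evalMonic (addConstant c (mulLinear s cs)) y
      ≡⟨ cong (λ m → s * c + y * m) (evalMonic-addConstant c (mulLinear s cs) y) ⟩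
    s * c + y * (c + evalMonic (mulLinear s cs) y)
      ≡⟨ cong (λ m → s * c + y * (c + m)) (evalMonic-mulLinear s cs y) ⟩
    s * c + y * (c + (y + s) * evalMonic cs y)
      ≡⟨ solve 4 (λ s c y m → s :* c :+ y :* (c :+ (y :+ s) :* m) := (y :+ s) :* (c :+ y :* m))
               refl s c y (evalMonic cs y) ⟩
    (y + s) * (c + y * evalMonic cs y)  ≡⟨ cong ((y + s) *_) (evalMonic-∷ c cs y) ⟨
    (y + s) * evalMonic (c ∷ cs) y      ∎

  private
    cancel : ∀ c r m → (c + r * m) + - r * m ≡ c
    cancel c r m = begin
      (c + r * m) + - r * m    ≡⟨ +-assoc c _ _ ⟩
      c + (r * m + - r * m)    ≡⟨ cong (c +_) (distribʳ m r (- r)) ⟨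
      c + (r + - r) * m        ≡⟨ cong (λ s → c + s * m) (-‿inverseʳ r) ⟩
      c + 0# * m               ≡⟨ cong (c +_) (zeroˡ m) ⟩
      c + 0#                   ≡⟨ +-identityʳ c ⟩
      c                        ∎

  -- The quotient of c by X - r (synthetic division).
  divLinear : ∀ {d} → Vec Carrier (suc d) → Carrier → Vec Carrier d
  divLinear {zero}  (c ∷ []) r = []
  divLinear {suc d} (c ∷ cs) r = evalMonic cs r ∷ divLinear cs r

  divLinear-spec : ∀ {d} (c : Vec Carrier (suc d)) r →
                   c ≡ addConstant (evalMonic c r) (mulLinear (- r) (divLinear c r))
  divLinear-spec {zero} (c ∷ []) r = cong (_∷ []) (begin
    c                               ≡⟨ cancel c r 1# ⟨
    (c + r * 1#) + - r * 1#
      ≡⟨ cong₂ (λ m n → (c + r * m) + n) (sym (evalMonic-[] r)) (*-identityʳ (- r)) ⟩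
    (c + r * evalMonic [] r) + - r  ≡⟨ cong (_+ - r) (evalMonic-∷ c [] r) ⟨
    evalMonic (c ∷ []) r + - r      ∎)
  divLinear-spec {suc d} (c ∷ cs) r = cong₂ _∷_ (begin
    c                                                ≡⟨ cancel c r (evalMonic cs r) ⟨
    (c + r * evalMonic cs r) + - r * evalMonic cs r  ≡⟨ cong (_+ - r * evalMonic cs r) (evalMonic-∷ c cs r) ⟨
    evalMonic (c ∷ cs) r + - r * evalMonic cs r      ∎) (divLinear-spec cs r)

  root⇒mulLinear : ∀ {d} (c : Vec Carrier (suc d)) {r} → IsRoot c r →
                   c ≡ mulLinear (- r) (divLinear c r)
  root⇒mulLinear c {r} root = begin
    c                                                    ≡⟨ divLinear-spec c r ⟩
    addConstant (evalMonic c r) (mulLinear (- r) (divLinear c r))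
      ≡⟨ cong (λ a → addConstant a (mulLinear (- r) (divLinear c r))) root ⟩
    addConstant 0# (mulLinear (- r) (divLinear c r))     ≡⟨ addConstant-zero _ ⟩
    mulLinear (- r) (divLinear c r)                      ∎

  divLinear-roots : ∀ {d} (c : Vec Carrier (suc d)) {r rs} → IsRoot c r →
                    All (r ≢_) rs → All (IsRoot c) rs → All (IsRoot (divLinear c r)) rs
  divLinear-roots c {r} r-root r∉rs roots = All.zipWith quotient-root (r∉rs , roots)
    where
    quotient-root : ∀ {s} → r ≢ s × IsRoot c s → IsRoot (divLinear c r) s
    quotient-root {s} (r≢s , s-root) = *-cancelˡ s-r≢0 (begin
      (s + - r) * evalMonic (divLinear c r) s        ≡⟨ evalMonic-mulLinear (- r) (divLinear c r) s ⟨
      evalMonic (mulLinear (- r) (divLinear c r)) s  ≡⟨ cong (λ m → evalMonic m s) (root⇒mulLinear c r-root) ⟨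
      evalMonic c s                                  ≡⟨ s-root ⟩
      0#                                             ≡⟨ zeroʳ _ ⟨
      (s + - r) * 0#                                 ∎)
      where
      s-r≢0 : s + - r ≢ 0#
      s-r≢0 s-r≡0 = r≢s (sym (x-y≡0⇒x≡y s-r≡0))

  roots-bound : ∀ {d} (c : Vec Carrier d) {rs} → Unique rs → All (IsRoot c) rs → length rs ≤ d
  roots-bound c {[]} _ _ = z≤n
  roots-bound [] {r ∷ _} _ (root ∷ _) = ⊥-elim (0≢1 (trans (sym root) (evalMonic-[] r)))
  roots-bound c@(_ ∷ _) {r ∷ rs} (r∉rs ∷ rs!) (root ∷ roots) =
    s≤s (roots-bound (divLinear c r) rs! (divLinear-roots c root r∉rs roots))

  prodLinear : ∀ {d} → Vec Carrier d → Vec Carrier d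
  prodLinear []       = []
  prodLinear (r ∷ rs) = mulLinear (- r) (prodLinear rs)

  evalMonic-prodLinear : ∀ {d} (rs : Vec Carrier d) y →
                         evalMonic (prodLinear rs) y ≡ product (map (λ r → y + - r) (toList rs))
  evalMonic-prodLinear []       y = evalMonic-[] y
  evalMonic-prodLinear (r ∷ rs) y =
    trans (evalMonic-mulLinear (- r) (prodLinear rs) y) (cong ((y + - r) *_) (evalMonic-prodLinear rs y))

  evalMonic-prodLinear-neg : ∀ {d} (rs : Vec Carrier d) c →
                             evalMonic (prodLinear rs) (- c) ≡ (- 1#) ^ d * product (toList (Vec.map (_+ c) rs))
  evalMonic-prodLinear-neg []               c = trans (evalMonic-[] (- c)) (sym (*-identityˡ 1#))
  evalMonic-prodLinear-neg {suc d} (r ∷ rs) c = begin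
    evalMonic (mulLinear (- r) (prodLinear rs)) (- c)  ≡⟨ evalMonic-mulLinear (- r) (prodLinear rs) (- c) ⟩
    (- c + - r) * evalMonic (prodLinear rs) (- c)      ≡⟨ cong₂ _*_ -c-r≡-1*[r+c] (evalMonic-prodLinear-neg rs c) ⟩
    (- 1# * (r + c)) * ((- 1#) ^ d * P)
      ≡⟨ solve 4 (λ m s a P → (m :* s) :* (a :* P) := (m :* a) :* (s :* P)) refl (- 1#) (r + c) ((- 1#) ^ d) P ⟩
    (- 1# * (- 1#) ^ d) * ((r + c) * P)                ∎
    where
    P = product (toList (Vec.map (_+ c) rs))
    -c-r≡-1*[r+c] : - c + - r ≡ - 1# * (r + c)
    -c-r≡-1*[r+c] = trans (+-comm (- c) (- r)) (trans (⁻¹-∙-comm r c) (sym (-1*x≈-x (r + c))))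

  prodLinear-root : ∀ {d} {rs : Vec Carrier d} {y} → y ∈ toList rs → IsRoot (prodLinear rs) y
  prodLinear-root {rs = r ∷ rs} {y} y∈rs = trans (evalMonic-prodLinear (r ∷ rs) y) (go y∈rs)
    where
    go : ∀ {rs} → y ∈ rs → product (map (λ r → y + - r) rs) ≡ 0#
    go {_ ∷ rs} (here refl) = trans (cong (_* product (map (λ r → y + - r) rs)) (-‿inverseʳ y)) (zeroˡ _)
    go (there y∈rs) = trans (cong (_ *_) (go y∈rs)) (zeroʳ _)

  prodLinear-root⁻ : DecidableEquality Carrier → ∀ {d} {rs : Vec Carrier d} {y} →
                     IsRoot (prodLinear rs) y → y ∈ toList rs
  prodLinear-root⁻ _≟_ {rs = rs} {y} root = go (toList rs) (trans (sym (evalMonic-prodLinear rs y)) root)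
    where
    go : ∀ rs → product (map (λ r → y + - r) rs) ≡ 0# → y ∈ rs
    go []       1≡0 = ⊥-elim (0≢1 (sym 1≡0))
    go (r ∷ rs) ∏≡0 with y ≟ r
    ... | yes y≡r = here y≡r
    ... | no  y≢r = there (go rs (*-cancelˡ (y≢r ∘ x-y≡0⇒x≡y) (trans ∏≡0 (sym (zeroʳ _)))))

  roots⇒≡prodLinear : ∀ {d} {rs : Vec Carrier d} (c : Vec Carrier d) → Unique (toList rs) →
                      All (IsRoot c) (toList rs) → c ≡ prodLinear rs
  roots⇒≡prodLinear {rs = []}     []  _ _ = refl
  roots⇒≡prodLinear {rs = r ∷ rs} c (r∉rs ∷ rs!) (root ∷ roots) = begin
    c                                ≡⟨ root⇒mulLinear c root ⟩
    mulLinear (- r) (divLinear c r)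
      ≡⟨ cong (mulLinear (- r)) (roots⇒≡prodLinear (divLinear c r) rs! quotient-roots) ⟩
    mulLinear (- r) (prodLinear rs)  ∎
    where
    quotient-roots = divLinear-roots c root r∉rs roots

  evalMonic-c∷zeros : ∀ d c y → evalMonic (c ∷ replicate d 0#) y ≡ c + y ^ suc d
  evalMonic-c∷zeros d c y = begin
    (c + y * eval (replicate d 0#) y) + y * y ^ d  ≡⟨ cong (λ z → (c + y * z) + y ^ suc d) (eval-zeros d) ⟩
    (c + y * 0#) + y ^ suc d                       ≡⟨ cong (λ z → (c + z) + y ^ suc d) (zeroʳ y) ⟩
    (c + 0#) + y ^ suc d                           ≡⟨ cong (_+ y ^ suc d) (+-identityʳ c) ⟩
    c + y ^ suc d                                  ∎
    where
    eval-zeros : ∀ d → eval (replicate d 0#) y ≡ 0#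
    eval-zeros zero    = refl
    eval-zeros (suc d) = trans (cong (λ z → 0# + y * z) (eval-zeros d))
                               (trans (+-identityˡ _) (zeroʳ y))

  roots-of-unity-bound : ∀ {m xs} → 0 ℕ.< m → Unique xs → All (λ x → x ^ m ≡ 1#) xs → length xs ≤ m
  roots-of-unity-bound {suc d} _ xs! unities = roots-bound (- 1# ∷ replicate d 0#) xs! (All.map root unities)
    where
    root : ∀ {x} → x ^ suc d ≡ 1# → IsRoot (- 1# ∷ replicate d 0#) x
    root {x} x^d+1≡1 = begin
      evalMonic (- 1# ∷ replicate d 0#) x  ≡⟨ evalMonic-c∷zeros d (- 1#) x ⟩
      - 1# + x ^ suc d                     ≡⟨ cong (- 1# +_) x^d+1≡1 ⟩
      - 1# + 1#                            ≡⟨ -‿inverseˡ 1# ⟩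
      0#                                   ∎

  module _ {φ : Carrier → Carrier} (φ-+ : ∀ x y → φ (x + y) ≡ φ x + φ y)
           (φ-* : ∀ x y → φ (x * y) ≡ φ x * φ y) (φ-1 : φ 1# ≡ 1#) where

    evalMonic-map : ∀ {d} (c : Vec Carrier d) y → evalMonic (Vec.map φ c) (φ y) ≡ φ (evalMonic c y)
    evalMonic-map [] y = begin
      evalMonic [] (φ y)   ≡⟨ evalMonic-[] (φ y) ⟩
      1#                   ≡⟨ φ-1 ⟨
      φ 1#                 ≡⟨ cong φ (evalMonic-[] y) ⟨
      φ (evalMonic [] y)   ∎
    evalMonic-map (c ∷ cs) y = begin
      evalMonic (φ c ∷ Vec.map φ cs) (φ y)         ≡⟨ evalMonic-∷ (φ c) (Vec.map φ cs) (φ y) ⟩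
      φ c + φ y * evalMonic (Vec.map φ cs) (φ y)   ≡⟨ cong (λ m → φ c + φ y * m) (evalMonic-map cs y) ⟩
      φ c + φ y * φ (evalMonic cs y)               ≡⟨ cong (φ c +_) (φ-* y _) ⟨
      φ c + φ (y * evalMonic cs y)                 ≡⟨ φ-+ c _ ⟨
      φ (c + y * evalMonic cs y)                   ≡⟨ cong φ (evalMonic-∷ c cs y) ⟨
      φ (evalMonic (c ∷ cs) y)                     ∎

module FiniteField (K : Field) (F : Subfield K) {Q p n : ℕ} (p-prime : Prime p)
                   (K! : HasSize {Field.Carrier K} (λ _ → ⊤) Q) (F! : HasSize (Subfield.In F) (p ℕ.^ n)) where
  open FieldAlgebra K
  open Subfield F
  open FieldTranslation K
  open Counting
  open MonicPolynomial K using (roots-of-unity-bound)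
  open import Data.Empty using (⊥-elim)
  open import Data.List using ([]; _∷_)
  import Data.List.Membership.DecPropositional as DecMembership
  open import Data.List.Relation.Unary.Any using (here)
  open import Data.List.Relation.Unary.All as All using (All; []; _∷_)
  open import Data.List.Relation.Unary.AllPairs using ([]; _∷_)
  open import Data.Nat as ℕ using (ℕ; zero; suc; _∸_; _<_; _≤_; s≤s; z≤n)
  import Data.Nat.Properties as ℕ
  open import Data.Product using (Σ; _,_; proj₁; proj₂)
  open import Data.Unit using (tt)
  open import Function.Bundles using (Equivalence; mk⇔)
  open import Relation.Binary.Definitions using (DecidableEquality; tri<; tri≈; tri>)
  open import Relation.Nullary using (yes; no)
  open import Relation.Unary using (Decidable; _∩_)
  open import Relation.Unary.Properties using (∁?)
  open import Function.Base using (_∘_)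
  open ≡-Reasoning

  q : ℕ
  q = p ℕ.^ n

  infix 4 _≟_
  _≟_ : DecidableEquality Carrier
  _≟_ = enumeration⇒≟ (proj₁ K!) (λ x → Equivalence.from (proj₁ (proj₂ (proj₂ K!)) x) tt)

  In? : Decidable In
  In? x with DecMembership._∈?_ _≟_ x (proj₁ F!)
  ... | yes x∈ = yes (Equivalence.to (proj₁ (proj₂ (proj₂ F!)) x) x∈)
  ... | no x∉  = no λ Inx → x∉ (Equivalence.from (proj₁ (proj₂ (proj₂ F!)) x) Inx)

  hasSize-nonZero : ∀ {P : Carrier → Set} {m} → P 0# → HasSize P m → HasSize (P ∩ (_≢ 0#)) (m ∸ 1)
  hasSize-nonZero {P} {m} P0 P! = subst (HasSize (P ∩ (_≢ 0#))) (cong ℕ.pred (sym m≡1+b)) P∖0!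
    where
    P∖0! = hasSize-∩ (∁? (_≟ 0#)) P!
    zero! : HasSize (P ∩ (_≡ 0#)) 1
    zero! = 0# ∷ [] , [] ∷ [] , (λ x → mk⇔ (λ { (here refl) → P0 , refl }) (λ { (_ , refl) → here refl }))
          , refl
    m≡1+b = hasSize-partition (_≟ 0#) P! zero! P∖0!

  units! : HasSize (_≢ 0#) (Q ∸ 1)
  units! = hasSize-resp-⇔ (λ x → mk⇔ proj₂ (tt ,_)) (hasSize-nonZero tt K!)

  subfieldUnits! : HasSize (In ∩ (_≢ 0#)) (q ∸ 1)
  subfieldUnits! = hasSize-nonZero In-0 F!

  private
    inverse-nonZero : ∀ {x y} → x * y ≡ 1# → y ≢ 0#
    inverse-nonZero {x} xy≡1 y≡0 = 0≢1 (trans (sym (zeroʳ x)) (trans (cong (x *_) (sym y≡0)) xy≡1))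

    ^-unpred : ∀ {m} x → 0 < m → x ^ m ≡ x * x ^ (m ∸ 1)
    ^-unpred {suc m} x _ = refl

    ^-fixes : ∀ {m x} → 0 < m → (x ≢ 0# → x ^ (m ∸ 1) ≡ 1#) → x ^ m ≡ x
    ^-fixes {suc m} {x} _ unit with x ≟ 0#
    ... | yes refl = zeroˡ _
    ... | no x≢0   = trans (cong (x *_) (unit x≢0)) (*-identityʳ x)

  0<Q : 0 < Q
  0<Q = hasSize⇒0< {x = 0#} K! tt

  0<q∸1 : 0 < q ∸ 1
  0<q∸1 = hasSize⇒0< subfieldUnits! (In-1 , λ 1≡0 → 0≢1 (sym 1≡0))

  0<q : 0 < q
  0<q = hasSize⇒0< F! In-0

  fermat : ∀ {x} → x ≢ 0# → x ^ (Q ∸ 1) ≡ 1#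
  fermat {x} x≢0 with x⁻¹ , xx⁻¹≡1 ← inverse x x≢0 =
    ^-size≡1 units! (λ y≢0 → y≢0) (*-nonZero x≢0) (*-nonZero (inverse-nonZero xx⁻¹≡1)) xx⁻¹≡1

  ^Q≡id : ∀ x → x ^ Q ≡ x
  ^Q≡id x = ^-fixes 0<Q fermat

  fermat-subfield : ∀ {x} → In x → x ≢ 0# → x ^ (q ∸ 1) ≡ 1#
  fermat-subfield {x} Inx x≢0 with x⁻¹ , xx⁻¹≡1 ← inverse x x≢0 =
    ^-size≡1 subfieldUnits! proj₂
      (λ (Iny , y≢0) → In-* Inx Iny , *-nonZero x≢0 y≢0)
      (λ (Iny , y≢0) → In-* (In-inv Inx xx⁻¹≡1) Iny , *-nonZero (inverse-nonZero xx⁻¹≡1) y≢0)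
      xx⁻¹≡1

  In⇒^q≡id : ∀ {x} → In x → x ^ q ≡ x
  In⇒^q≡id Inx = ^-fixes 0<q (fermat-subfield Inx)

  p·1≡0 : p · 1# ≡ 0#
  p·1≡0 with p · 1# ≟ 0#
  ... | yes p·1≡0 = p·1≡0
  ... | no  p·1≢0 = ⊥-elim (^-nonZero n p·1≢0 (trans (sym (·1-^ n)) q·1≡0))
    where
    q·1≡0 : q · 1# ≡ 0#
    q·1≡0 = ·-size≡0 F! (In-+ In-1) (In-+ (In-- In-1))
    ·1-^ : ∀ m → (p ℕ.^ m) · 1# ≡ (p · 1#) ^ m
    ·1-^ zero    = +-identityʳ 1#
    ·1-^ (suc m) = trans (×1-homo-* p (p ℕ.^ m)) (cong ((p · 1#) *_) (·1-^ m))

  open Frobenius K p-prime using (frobenius-^)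

  ^q-+ : ∀ x y → (x + y) ^ q ≡ x ^ q + y ^ q
  ^q-+ = frobenius-^ p·1≡0 n

  ^q≡id⇒In : ∀ {x} → x ^ q ≡ x → In x
  ^q≡id⇒In {x} x^q≡x with In? x
  ... | yes Inx = Inx
  ... | no ¬Inx with units , units! , units⇔ , |units| ← subfieldUnits! =
    ⊥-elim (ℕ.<-irrefl |units| (roots-of-unity-bound 0<q∸1 (x∉units ∷ units!) (x-unity ∷ units-unity)))
    where
    open Equivalence
    x∉units : All (x ≢_) units
    x∉units = All.tabulate (λ y∈units x≡y → ¬Inx (subst In (sym x≡y) (proj₁ (to (units⇔ _) y∈units))))
    x-unity : x ^ (q ∸ 1) ≡ 1#
    x-unity = *-cancelˡ (λ { refl → ¬Inx In-0 })
      (trans (sym (^-unpred x 0<q)) (trans x^q≡x (sym (*-identityʳ x))))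
    units-unity : All (λ y → y ^ (q ∸ 1) ≡ 1#) units
    units-unity = All.tabulate (λ y∈units → let Iny , y≢0 = to (units⇔ _) y∈units in fermat-subfield Iny y≢0)

  units-bound : ∀ {m} → 0 < m → (∀ {y} → y ≢ 0# → y ^ m ≡ 1#) → Q ∸ 1 ≤ m
  units-bound 0<m unity with xs , xs! , xs⇔ , |xs| ← units! =
    subst (_≤ _) |xs| (roots-of-unity-bound 0<m xs! (All.tabulate (unity ∘ Equivalence.to (xs⇔ _))))

  -- In a field with two elements ω = 0# would satisfy the generation hypothesis; 1 < Q ∸ 1 rules
  -- this out.
  module Generator (ω : Carrier) (ω-generates : ∀ x → x ≢ 0# → Σ ℕ (λ i → ω ^ i ≡ x))
                   (1<Q∸1 : 1 < Q ∸ 1) where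

    ω≢0 : ω ≢ 0#
    ω≢0 ω≡0 = ℕ.<⇒≱ 1<Q∸1 (units-bound (s≤s z≤n) unit≡1)
      where
      unit≡1 : ∀ {y} → y ≢ 0# → y ^ 1 ≡ 1#
      unit≡1 {y} y≢0 with ω-generates y y≢0
      ... | zero  , refl = ^-identityʳ 1#
      ... | suc i , refl = ⊥-elim (y≢0 (trans (cong (_* ω ^ i) ω≡0) (zeroˡ _)))

    ω^[Q∸1]≡1 : ω ^ (Q ∸ 1) ≡ 1#
    ω^[Q∸1]≡1 = fermat ω≢0

    ω-order : ∀ {j} → 0 < j → ω ^ j ≡ 1# → Q ∸ 1 ≤ j
    ω-order {j} 0<j ω^j≡1 = units-bound 0<j unity
      where
      unity : ∀ {y} → y ≢ 0# → y ^ j ≡ 1#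
      unity {y} y≢0 with i , refl ← ω-generates y y≢0 =
        trans (^-comm ω i j) (trans (cong (_^ i) ω^j≡1) (^-zeroˡ i))

    private
      ω^-distinct : ∀ {i j} → i < j → j < Q ∸ 1 → ω ^ i ≢ ω ^ j
      ω^-distinct {i} {j} i<j j<Q∸1 ω^i≡ω^j =
        ℕ.<⇒≱ (ℕ.≤-<-trans (ℕ.m∸n≤m j i) j<Q∸1) (ω-order (ℕ.m<n⇒0<n∸m i<j) ω^[j∸i]≡1)
        where
        ω^[j∸i]≡1 : ω ^ (j ∸ i) ≡ 1#
        ω^[j∸i]≡1 = *-cancelˡ (^-nonZero i ω≢0) (begin
          ω ^ i * ω ^ (j ∸ i)   ≡⟨ ^-distribˡ-+-* ω i (j ∸ i) ⟨
          ω ^ (i ℕ.+ (j ∸ i))   ≡⟨ cong (ω ^_) (ℕ.m+[n∸m]≡n (ℕ.<⇒≤ i<j)) ⟩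
          ω ^ j                 ≡⟨ ω^i≡ω^j ⟨
          ω ^ i                 ≡⟨ *-identityʳ _ ⟨
          ω ^ i * 1#            ∎)

    ω^-injective : ∀ {i j} → i < Q ∸ 1 → j < Q ∸ 1 → ω ^ i ≡ ω ^ j → i ≡ j
    ω^-injective {i} {j} i<Q∸1 j<Q∸1 ω^i≡ω^j with ℕ.<-cmp i j
    ... | tri≈ _ i≡j _ = i≡j
    ... | tri< i<j _ _ = ⊥-elim (ω^-distinct i<j j<Q∸1 ω^i≡ω^j)
    ... | tri> _ _ j<i = ⊥-elim (ω^-distinct j<i i<Q∸1 (sym ω^i≡ω^j))

module Conjugates (K : Field) (F : Subfield K) {p n ℓ : ℕ} (p-prime : Prime p) (ℓ-prime : Prime ℓ)
                  (K! : HasSize {Field.Carrier K} (λ _ → ⊤) ((p ℕ.^ n) ℕ.^ ℓ))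
                  (F! : HasSize (Subfield.In F) (p ℕ.^ n)) where
  open FieldAlgebra K
  open Subfield F
  open FiniteField K F {n = n} p-prime K! F!
  open MonicPolynomial K
  open PrimeArithmetic using (prime>1; prime≢2⇒odd)
  open GeometricSeries using (geometric)
  open import Data.List.Membership.Propositional using (_∈_)
  open import Data.List.Relation.Unary.Any using (here; there)
  open import Data.List.Relation.Unary.All as All using (All; []; _∷_)
  open import Data.List.Relation.Unary.AllPairs using ([]; _∷_)
  open import Data.List.Relation.Unary.Unique.Propositional using (Unique)
  open import Data.Nat as ℕ using (ℕ; zero; suc; _<_; _≤_; _∸_; s≤s; z≤n)
  import Data.Nat.Properties as ℕ
  open import Data.Nat.Coprimality using (prime⇒coprime; coprime-Bézout)
  open import Data.Nat.GCD using (module Bézout)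
  open import Data.Product using (∃-syntax; _×_; _,_)
  open import Data.Vec as Vec using (Vec; []; _∷_; toList)
  import Data.Vec.Properties as Vec
  import Data.Vec.Relation.Unary.All as VecAll
  open VecAll using ([]; _∷_)
  open import Relation.Nullary using (¬_)
  open ≡-Reasoning

  ^q^-+ : ∀ x i j → x ^ (q ℕ.^ (i ℕ.+ j)) ≡ (x ^ (q ℕ.^ i)) ^ (q ℕ.^ j)
  ^q^-+ x i j = trans (cong (x ^_) (ℕ.^-distribˡ-+-* q i j)) (sym (^-*-assoc x (q ℕ.^ i) (q ℕ.^ j)))

  Fixed : ℕ → Carrier → Set
  Fixed d x = x ^ (q ℕ.^ d) ≡ x

  fixed-ℓ : ∀ x → Fixed ℓ x
  fixed-ℓ = ^Q≡id

  fixed-* : ∀ {d x} → Fixed d x → ∀ t → Fixed (t ℕ.* d) x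
  fixed-* {d} {x} _      zero    = ^-identityʳ x
  fixed-* {d} {x} fixed (suc t) = begin
    x ^ (q ℕ.^ (d ℕ.+ t ℕ.* d))          ≡⟨ ^q^-+ x d (t ℕ.* d) ⟩
    (x ^ (q ℕ.^ d)) ^ (q ℕ.^ (t ℕ.* d))  ≡⟨ cong (_^ (q ℕ.^ (t ℕ.* d))) fixed ⟩
    x ^ (q ℕ.^ (t ℕ.* d))                ≡⟨ fixed-* fixed t ⟩
    x                                    ∎

  fixed-∸ : ∀ {i j x} → Fixed i x → Fixed (i ℕ.+ j) x → Fixed j x
  fixed-∸ {i} {j} {x} fixed-i fixed-i+j = begin
    x ^ (q ℕ.^ j)                 ≡⟨ cong (λ y → y ^ (q ℕ.^ j)) fixed-i ⟨
    (x ^ (q ℕ.^ i)) ^ (q ℕ.^ j)   ≡⟨ ^q^-+ x i j ⟨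
    x ^ (q ℕ.^ (i ℕ.+ j))         ≡⟨ fixed-i+j ⟩
    x                             ∎

  fixed-1⇒In : ∀ {x} → Fixed 1 x → In x
  fixed-1⇒In {x} fixed-1 = ^q≡id⇒In (trans (cong (x ^_) (sym (ℕ.*-identityʳ q))) fixed-1)

  fixed-suc : ∀ {a b x} → Fixed a x → Fixed b x → 1 ℕ.+ a ≡ b → Fixed 1 x
  fixed-suc {a} {b} {x} fixed-a fixed-b 1+a≡b =
    fixed-∸ {a} {1} fixed-a (subst (λ m → Fixed m x) (sym (trans (ℕ.+-comm a 1) 1+a≡b)) fixed-b)

  fixed⇒In : ∀ {d x} → 0 < d → d < ℓ → Fixed d x → In x
  fixed⇒In {d} {x} 0<d d<ℓ fixed-d with coprime-Bézout (prime⇒coprime ℓ-prime {{ℕ.>-nonZero 0<d}} d<ℓ)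
  ... | Bézout.+- a b 1+bd≡aℓ = fixed-1⇒In (fixed-suc (fixed-* fixed-d b) (fixed-* (fixed-ℓ x) a) 1+bd≡aℓ)
  ... | Bézout.-+ a b 1+aℓ≡bd = fixed-1⇒In (fixed-suc (fixed-* (fixed-ℓ x) a) (fixed-* fixed-d b) 1+aℓ≡bd)

  In-^ : ∀ {a} m → In a → In (a ^ m)
  In-^ zero    _   = In-1
  In-^ (suc m) Ina = In-* Ina (In-^ m Ina)

  conjugates : Carrier → (l : ℕ) → Vec Carrier l
  conjugates x zero    = []
  conjugates x (suc l) = x ∷ conjugates (x ^ q) l

  ^q^-suc : ∀ x i → (x ^ q) ^ (q ℕ.^ i) ≡ x ^ (q ℕ.^ suc i)
  ^q^-suc x i = ^-*-assoc x q (q ℕ.^ i)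

  ^q^-sucʳ : ∀ x i → (x ^ (q ℕ.^ i)) ^ q ≡ x ^ (q ℕ.^ suc i)
  ^q^-sucʳ x i = trans (^-*-assoc x (q ℕ.^ i) q) (cong (x ^_) (ℕ.*-comm (q ℕ.^ i) q))

  ∈-conjugates⁻ : ∀ {x l y} → y ∈ toList (conjugates x l) → ∃[ i ] (i < l × y ≡ x ^ (q ℕ.^ i))
  ∈-conjugates⁻ {x} {suc l} (here refl) = 0 , s≤s z≤n , sym (^-identityʳ x)
  ∈-conjugates⁻ {x} {suc l} (there y∈) with i , i<l , refl ← ∈-conjugates⁻ {x ^ q} {l} y∈ =
    suc i , s≤s i<l , ^q^-suc x i

  ∈-conjugates⁺ : ∀ {x l i} → i < l → x ^ (q ℕ.^ i) ∈ toList (conjugates x l)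
  ∈-conjugates⁺ {x} {suc l} {zero}  _         = here (^-identityʳ x)
  ∈-conjugates⁺ {x} {suc l} {suc i} (s≤s i<l) =
    there (subst (_∈ toList (conjugates (x ^ q) l)) (^q^-suc x i) (∈-conjugates⁺ i<l))

  0<ℓ : 0 < ℓ
  0<ℓ = ℕ.<-trans (s≤s z≤n) (prime>1 ℓ-prime)

  x∈conjugates : ∀ x → x ∈ toList (conjugates x ℓ)
  x∈conjugates x = subst (_∈ toList (conjugates x ℓ)) (^-identityʳ x) (∈-conjugates⁺ 0<ℓ)

  x^q∈conjugates : ∀ x → x ^ q ∈ toList (conjugates x ℓ)
  x^q∈conjugates x =
    subst (_∈ toList (conjugates x ℓ)) (cong (x ^_) (ℕ.*-identityʳ q)) (∈-conjugates⁺ (prime>1 ℓ-prime))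

  conjugate⇒¬In : ∀ {x y} → ¬ In x → y ∈ toList (conjugates x ℓ) → ¬ In y
  conjugate⇒¬In {x} ¬Inx y∈ Iny with i , i<ℓ , refl ← ∈-conjugates⁻ y∈ =
    ¬Inx (subst In x^q^ℓ≡x (In-^ (q ℕ.^ (ℓ ∸ i)) Iny))
    where
    x^q^ℓ≡x : (x ^ (q ℕ.^ i)) ^ (q ℕ.^ (ℓ ∸ i)) ≡ x
    x^q^ℓ≡x = begin
      (x ^ (q ℕ.^ i)) ^ (q ℕ.^ (ℓ ∸ i))  ≡⟨ ^q^-+ x i (ℓ ∸ i) ⟨
      x ^ (q ℕ.^ (i ℕ.+ (ℓ ∸ i)))        ≡⟨ cong (λ m → x ^ (q ℕ.^ m)) (ℕ.m+[n∸m]≡n (ℕ.<⇒≤ i<ℓ)) ⟩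
      x ^ (q ℕ.^ ℓ)                      ≡⟨ fixed-ℓ x ⟩
      x                                  ∎

  conjugates-unique : ∀ {x} → ¬ In x → Unique (toList (conjugates x ℓ))
  conjugates-unique = go ℕ.≤-refl
    where
    go : ∀ {l x} → l ≤ ℓ → ¬ In x → Unique (toList (conjugates x l))
    go {zero}      _   _    = []
    go {suc l} {x} l<ℓ ¬Inx = All.tabulate x≢ ∷ go (ℕ.<⇒≤ l<ℓ) (conjugate⇒¬In ¬Inx (x^q∈conjugates x))
      where
      x≢ : ∀ {y} → y ∈ toList (conjugates (x ^ q) l) → x ≢ y
      x≢ y∈ x≡y with i , i<l , refl ← ∈-conjugates⁻ y∈ =
        ¬Inx (fixed⇒In (s≤s z≤n) (ℕ.≤-trans (s≤s i<l) l<ℓ) (trans (sym (^q^-suc x i)) (sym x≡y)))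

  minPoly : Carrier → Vec Carrier ℓ
  minPoly x = prodLinear (conjugates x ℓ)

  private
    0^q≡0 : 0# ^ q ≡ 0#
    0^q≡0 = In⇒^q≡id In-0

    map-^q-In : ∀ {d} {c : Vec Carrier d} → VecAll.All In c → Vec.map (_^ q) c ≡ c
    map-^q-In []           = refl
    map-^q-In (Inc ∷ Incs) = cong₂ _∷_ (In⇒^q≡id Inc) (map-^q-In Incs)

    map-^q-fixed : ∀ {d} (c : Vec Carrier d) → Vec.map (_^ q) c ≡ c → VecAll.All In c
    map-^q-fixed []       _  = []
    map-^q-fixed (c ∷ cs) eq with c^q≡c , eqs ← Vec.∷-injective eq = ^q≡id⇒In c^q≡c ∷ map-^q-fixed cs eqs

  evalMonic-^q : ∀ {d} (c : Vec Carrier d) y → evalMonic (Vec.map (_^ q) c) (y ^ q) ≡ evalMonic c y ^ q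
  evalMonic-^q = evalMonic-map ^q-+ (λ x y → ^-distribʳ-* x y q) (^-zeroˡ q)

  root-^q : ∀ {d} {c : Vec Carrier d} {y} → VecAll.All In c → IsRoot c y → IsRoot c (y ^ q)
  root-^q {c = c} {y} c∈F root = begin
    evalMonic c (y ^ q)                   ≡⟨ cong (λ c → evalMonic c (y ^ q)) (map-^q-In c∈F) ⟨
    evalMonic (Vec.map (_^ q) c) (y ^ q)  ≡⟨ evalMonic-^q c y ⟩
    evalMonic c y ^ q                     ≡⟨ cong (_^ q) root ⟩
    0# ^ q                                ≡⟨ 0^q≡0 ⟩
    0#                                    ∎

  conjugates-roots : ∀ {d} {c : Vec Carrier d} {x} → VecAll.All In c → IsRoot c x →
                     ∀ l → All (IsRoot c) (toList (conjugates x l))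
  conjugates-roots c∈F root zero    = []
  conjugates-roots c∈F root (suc l) = root ∷ conjugates-roots c∈F (root-^q c∈F root) l

  conjugate-preimage : ∀ {x y} → y ∈ toList (conjugates x ℓ) →
                       ∃[ z ] (z ∈ toList (conjugates x ℓ) × z ^ q ≡ y)
  conjugate-preimage {x} y∈ with ∈-conjugates⁻ y∈
  ... | suc i , i+1<ℓ , refl = x ^ (q ℕ.^ i) , ∈-conjugates⁺ (ℕ.<-trans (ℕ.n<1+n i) i+1<ℓ) , ^q^-sucʳ x i
  ... | zero  , _     , refl =
    x ^ (q ℕ.^ ℕ.pred ℓ) , ∈-conjugates⁺ (subst (ℕ.pred ℓ <_) suc-pred[ℓ] ℕ.≤-refl) , (begin
    (x ^ (q ℕ.^ ℕ.pred ℓ)) ^ q   ≡⟨ ^q^-sucʳ x (ℕ.pred ℓ) ⟩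
    x ^ (q ℕ.^ suc (ℕ.pred ℓ))   ≡⟨ cong (λ m → x ^ (q ℕ.^ m)) suc-pred[ℓ] ⟩
    x ^ (q ℕ.^ ℓ)                ≡⟨ fixed-ℓ x ⟩
    x                            ≡⟨ ^-identityʳ x ⟨
    x ^ (q ℕ.^ 0)                ∎)
    where
    suc-pred[ℓ] : suc (ℕ.pred ℓ) ≡ ℓ
    suc-pred[ℓ] = ℕ.suc-pred ℓ {{ℕ.>-nonZero 0<ℓ}}

  minPoly-root : ∀ {x y} → y ∈ toList (conjugates x ℓ) → IsRoot (minPoly x) y
  minPoly-root = prodLinear-root

  -- The Frobenius image of minPoly x vanishes on the (Frobenius-stable) conjugates of x,
  -- so it is minPoly x again.
  minPoly-coefficients : ∀ {x} → ¬ In x → VecAll.All In (minPoly x)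
  minPoly-coefficients {x} ¬Inx =
    map-^q-fixed (minPoly x) (roots⇒≡prodLinear _ (conjugates-unique ¬Inx) (All.tabulate root))
    where
    root : ∀ {y} → y ∈ toList (conjugates x ℓ) → IsRoot (Vec.map (_^ q) (minPoly x)) y
    root y∈ with z , z∈ , refl ← conjugate-preimage y∈ = begin
      evalMonic (Vec.map (_^ q) (minPoly x)) (z ^ q)   ≡⟨ evalMonic-^q (minPoly x) z ⟩
      evalMonic (minPoly x) z ^ q                      ≡⟨ cong (_^ q) (minPoly-root z∈) ⟩
      0# ^ q                                           ≡⟨ 0^q≡0 ⟩
      0#                                               ∎

  root⇒≡minPoly : ∀ {x} {m : Vec Carrier ℓ} → ¬ In x → VecAll.All In m → IsRoot m x → m ≡ minPoly x
  root⇒≡minPoly ¬Inx m∈F root = roots⇒≡prodLinear _ (conjugates-unique ¬Inx) (conjugates-roots m∈F root ℓ)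

  minPoly-isMin : ∀ {x} → ¬ In x → IsMinPolyOfDegree F ℓ x (minPoly x)
  minPoly-isMin {x} ¬Inx = minPoly-coefficients ¬Inx , minPoly-root (x∈conjugates x) , smaller
    where
    smaller : ∀ d → d < ℓ → (c : Vec Carrier d) → VecAll.All In c → ¬ IsRoot c x
    smaller d d<ℓ c c∈F root = ℕ.<⇒≱ d<ℓ (subst (_≤ d) (Vec.length-toList (conjugates x ℓ))
      (roots-bound c (conjugates-unique ¬Inx) (conjugates-roots c∈F root ℓ)))

  isMin⇒¬In : ∀ {x m} → IsMinPolyOfDegree F ℓ x m → ¬ In x
  isMin⇒¬In {x} (_ , _ , smaller) Inx = smaller 1 (prime>1 ℓ-prime) (- x ∷ []) (In-- Inx ∷ []) (begin
    evalMonic (- x ∷ []) x      ≡⟨ evalMonic-∷ (- x) [] x ⟩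
    - x + x * evalMonic [] x    ≡⟨ cong (λ m → - x + x * m) (evalMonic-[] x) ⟩
    - x + x * 1#                ≡⟨ cong (- x +_) (*-identityʳ x) ⟩
    - x + x                     ≡⟨ -‿inverseˡ x ⟩
    0#                          ∎)

  isMin⇒≡minPoly : ∀ {x m} → IsMinPolyOfDegree F ℓ x m → m ≡ minPoly x
  isMin⇒≡minPoly isMin@(m∈F , root , _) = root⇒≡minPoly (isMin⇒¬In isMin) m∈F root

  conjugate⇒≡minPoly : ∀ {x y} → ¬ In x → y ∈ toList (conjugates x ℓ) → minPoly x ≡ minPoly y
  conjugate⇒≡minPoly ¬Inx y∈ =
    root⇒≡minPoly (conjugate⇒¬In ¬Inx y∈) (minPoly-coefficients ¬Inx) (minPoly-root y∈)

  ≡minPoly⇒conjugate : ∀ {x y} → minPoly y ≡ minPoly x → y ∈ toList (conjugates x ℓ)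
  ≡minPoly⇒conjugate {x} {y} eq =
    prodLinear-root⁻ _≟_ (subst (λ m → IsRoot m y) eq (minPoly-root (x∈conjugates y)))

  product-conjugates : ∀ x l → product (toList (conjugates x l)) ≡ x ^ geometric q l
  product-conjugates x zero    = refl
  product-conjugates x (suc l) =
    cong (x *_) (trans (product-conjugates (x ^ q) l) (^-*-assoc x q (geometric q l)))

  In⇒^geometric : ∀ {x} → In x → ∀ l → x ^ geometric q l ≡ x ^ l
  In⇒^geometric Inx zero    = refl
  In⇒^geometric {x} Inx (suc l) = cong (x *_) (begin
    x ^ (q ℕ.* geometric q l)     ≡⟨ ^-*-assoc x q (geometric q l) ⟨
    (x ^ q) ^ geometric q l       ≡⟨ cong (_^ geometric q l) (In⇒^q≡id Inx) ⟩
    x ^ geometric q l             ≡⟨ In⇒^geometric Inx l ⟩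
    x ^ l                       ∎)

  conjugates-+ : ∀ {c} → In c → ∀ x l → conjugates (x + c) l ≡ Vec.map (_+ c) (conjugates x l)
  conjugates-+ Inc x zero    = refl
  conjugates-+ {c} Inc x (suc l) = cong ((x + c) ∷_) (begin
    conjugates ((x + c) ^ q) l              ≡⟨ cong (λ y → conjugates y l) (^q-+ x c) ⟩
    conjugates (x ^ q + c ^ q) l            ≡⟨ cong (λ y → conjugates (x ^ q + y) l) (In⇒^q≡id Inc) ⟩
    conjugates (x ^ q + c) l                ≡⟨ conjugates-+ Inc (x ^ q) l ⟩
    Vec.map (_+ c) (conjugates (x ^ q) l)   ∎)

  minPoly-at-neg : ℓ ≢ 2 → ∀ {c} → In c → ∀ x → evalMonic (minPoly x) (- c) ≡ - ((x + c) ^ geometric q ℓ)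
  minPoly-at-neg ℓ≢2 {c} Inc x = begin
    evalMonic (minPoly x) (- c)
      ≡⟨ evalMonic-prodLinear-neg (conjugates x ℓ) c ⟩
    (- 1#) ^ ℓ * product (toList (Vec.map (_+ c) (conjugates x ℓ)))
      ≡⟨ cong (λ v → (- 1#) ^ ℓ * product (toList v)) (conjugates-+ Inc x ℓ) ⟨
    (- 1#) ^ ℓ * product (toList (conjugates (x + c) ℓ))
      ≡⟨ cong₂ _*_ -1^ℓ≡-1 (product-conjugates (x + c) ℓ) ⟩
    - 1# * (x + c) ^ geometric q ℓ
      ≡⟨ -1*x≈-x _ ⟩
    - ((x + c) ^ geometric q ℓ)
      ∎
    where
    -1^ℓ≡-1 : (- 1#) ^ ℓ ≡ - 1#
    -1^ℓ≡-1 = trans (cong ((- 1#) ^_) (prime≢2⇒odd ℓ-prime ℓ≢2)) (-1^-odd (ℓ ℕ./ 2))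

module CyclotomicNumbers (K : Field) (F : Subfield K) {p n ℓ : ℕ} (p-prime : Prime p)
                         (ℓ-prime : Prime ℓ) (ℓ≢2 : ℓ ≢ 2)
                         (K! : HasSize {Field.Carrier K} (λ _ → ⊤) ((p ℕ.^ n) ℕ.^ ℓ))
                         (F! : HasSize (Subfield.In F) (p ℕ.^ n))
                         (ω : Field.Carrier K)
                         (ω-generates : ∀ x → x ≢ Field.0# K → Σ ℕ (λ i → Field._^_ K ω i ≡ x))
                         {k : ℕ} (k*e≡Q∸1 : k ℕ.* (p ℕ.^ n ℕ.∸ 1) ≡ (p ℕ.^ n) ℕ.^ ℓ ℕ.∸ 1) where
  open FieldAlgebra K
  open Subfield F
  open FiniteField K F {n = n} p-prime K! F!
  open Conjugates K F {n = n} p-prime ℓ-prime K! F!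
  open Cyclotomy K F ω (q ℕ.∸ 1) k ℓ using (InC; CycloSet; TSet; ISet)
  open Counting
  open GeometricSeries
  open PrimeArithmetic using (prime>1)
  open import Data.Nat as ℕ using (ℕ; suc; _<_; _≤_; _∸_; s≤s; z≤n)
  open import Data.Nat.DivMod using (m%n<n)
  import Data.Nat.Properties as ℕ
  open import Data.Product using (_×_; _,_)
  open import Data.List.Membership.Propositional using (_∈_)
  open import Data.Vec as Vec using (Vec; toList)
  import Data.Vec.Properties as Vec
  open import Function.Bundles using (_⇔_; mk⇔)
  open import Relation.Nullary using (¬_)
  open import Relation.Unary using (_∩_; ∁)
  open import Relation.Unary.Properties using (∁?)
  open ≡-Reasoning

  e : ℕ
  e = q ∸ 1

  instance
    e≢0 : ℕ.NonZero e
    e≢0 = ℕ.>-nonZero 0<q∸1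

  Q∸1≡geometric*e : q ℕ.^ ℓ ∸ 1 ≡ geometric q ℓ ℕ.* e
  Q∸1≡geometric*e = trans (cong (_∸ 1) (sym (geometric-*-pred 0<q ℓ))) (ℕ.m+n∸n≡m _ 1)

  k≡geometric : k ≡ geometric q ℓ
  k≡geometric = ℕ.*-cancelʳ-≡ k (geometric q ℓ) e (trans k*e≡Q∸1 Q∸1≡geometric*e)

  1<k : 1 < k
  1<k = subst (1 <_) (sym k≡geometric) (1<geometric 0<q (prime>1 ℓ-prime))

  instance
    k≢0 : ℕ.NonZero k
    k≢0 = ℕ.>-nonZero (ℕ.<-trans (s≤s z≤n) 1<k)

  e*k≡Q∸1 : e ℕ.* k ≡ q ℕ.^ ℓ ∸ 1
  e*k≡Q∸1 = trans (ℕ.*-comm e k) k*e≡Q∸1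

  1<Q∸1 : 1 < q ℕ.^ ℓ ∸ 1
  1<Q∸1 = subst (1 <_) k*e≡Q∸1 (ℕ.*-mono-≤ 1<k 0<q∸1)

  open Generator ω ω-generates 1<Q∸1

  InC⇒norm : ∀ {a x} → InC a x → x ^ k ≡ ω ^ (a ℕ.* k)
  InC⇒norm {a} (j , refl) = begin
    (ω ^ a * (ω ^ e) ^ j) ^ k          ≡⟨ ^-distribʳ-* (ω ^ a) ((ω ^ e) ^ j) k ⟩
    (ω ^ a) ^ k * ((ω ^ e) ^ j) ^ k    ≡⟨ cong₂ _*_ (^-*-assoc ω a k) (^-comm (ω ^ e) j k) ⟩
    ω ^ (a ℕ.* k) * ((ω ^ e) ^ k) ^ j  ≡⟨ cong (λ z → ω ^ (a ℕ.* k) * z ^ j) ω^e^k≡1 ⟩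
    ω ^ (a ℕ.* k) * 1# ^ j             ≡⟨ cong (ω ^ (a ℕ.* k) *_) (^-zeroˡ j) ⟩
    ω ^ (a ℕ.* k) * 1#                 ≡⟨ *-identityʳ _ ⟩
    ω ^ (a ℕ.* k)                      ∎
    where
    ω^e^k≡1 : (ω ^ e) ^ k ≡ 1#
    ω^e^k≡1 = trans (^-*-assoc ω e k) (trans (cong (ω ^_) e*k≡Q∸1) ω^[Q∸1]≡1)

  -- Write x = ω ^ s with s = r + e t, r < e; comparing norms gives ω ^ (r k) = ω ^ (a k) with
  -- both exponents below Q - 1, so r = a.
  norm⇒InC : ∀ {a x} → a < e → x ^ k ≡ ω ^ (a ℕ.* k) → InC a x
  norm⇒InC {a} {x} a<e x^k≡ω^ak with ω-generates x x≢0
    where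
    x≢0 : x ≢ 0#
    x≢0 refl = ^-nonZero (a ℕ.* k) ω≢0 (trans (sym x^k≡ω^ak) (0^m≡0 (ℕ.>-nonZero⁻¹ k)))
  ... | s , refl = subst (λ r → InC r (ω ^ s)) r≡a ω^s∈C[s%e]
    where
    ω^s∈C[s%e] : InC (s ℕ.% e) (ω ^ s)
    ω^s∈C[s%e] = s ℕ./ e , ^-divMod ω s e
    r*k<Q∸1 : ∀ {r} → r < e → r ℕ.* k < q ℕ.^ ℓ ∸ 1
    r*k<Q∸1 {r} r<e = subst (r ℕ.* k <_) e*k≡Q∸1 (ℕ.*-monoˡ-< k r<e)
    r≡a : s ℕ.% e ≡ a
    r≡a = ℕ.*-cancelʳ-≡ _ a k (ω^-injective (r*k<Q∸1 (m%n<n s e)) (r*k<Q∸1 a<e)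
            (trans (sym (InC⇒norm {s ℕ.% e} ω^s∈C[s%e])) x^k≡ω^ak))

  In⇒^k≡^ℓ : ∀ {y} → In y → y ^ k ≡ y ^ ℓ
  In⇒^k≡^ℓ {y} Iny = trans (cong (y ^_) k≡geometric) (In⇒^geometric Iny ℓ)

  minPoly-at-0 : ∀ x → evalMonic (minPoly x) 0# ≡ - (x ^ k)
  minPoly-at-0 x = begin
    evalMonic (minPoly x) 0#        ≡⟨ cong (evalMonic (minPoly x)) -0#≈0# ⟨
    evalMonic (minPoly x) (- 0#)    ≡⟨ minPoly-at-neg ℓ≢2 In-0 x ⟩
    - ((x + 0#) ^ geometric q ℓ)    ≡⟨ cong₂ (λ y m → - (y ^ m)) (+-identityʳ x) (sym k≡geometric) ⟩
    - (x ^ k)                       ∎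

  minPoly-at-1 : ∀ x → evalMonic (minPoly x) (- 1#) ≡ - ((x + 1#) ^ k)
  minPoly-at-1 x = trans (minPoly-at-neg ℓ≢2 In-1 x) (cong (λ m → - ((x + 1#) ^ m)) (sym k≡geometric))

  module _ (a b : ℕ) where

    HasNorms : Carrier → Set
    HasNorms x = x ^ k ≡ ω ^ (a ℕ.* k) × (x + 1#) ^ k ≡ ω ^ (b ℕ.* k)

    CycloSet⇔HasNorms : a < e → b < e → ∀ x → CycloSet a b x ⇔ HasNorms x
    CycloSet⇔HasNorms a<e b<e x = mk⇔
      (λ (x∈Ca , x+1∈Cb) → InC⇒norm {a} x∈Ca , InC⇒norm {b} x+1∈Cb)
      (λ (Nx , Nx+1) → norm⇒InC a<e Nx , norm⇒InC b<e Nx+1)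

    TSet⇔HasNorms∩In : ∀ x → TSet a b x ⇔ (HasNorms ∩ In) x
    TSet⇔HasNorms∩In x = mk⇔
      (λ (Inx , x^ℓ≡ , [x+1]^ℓ≡) →
        (trans (In⇒^k≡^ℓ Inx) x^ℓ≡ , trans (In⇒^k≡^ℓ (In-+ Inx In-1)) [x+1]^ℓ≡) , Inx)
      (λ ((x^k≡ , [x+1]^k≡) , Inx) →
        Inx , trans (sym (In⇒^k≡^ℓ Inx)) x^k≡ , trans (sym (In⇒^k≡^ℓ (In-+ Inx In-1))) [x+1]^k≡)

    HasNorms⇒ISet : ∀ {x} → ¬ In x → HasNorms x → ISet a b (minPoly x)
    HasNorms⇒ISet {x} ¬Inx (x^k≡ , [x+1]^k≡) =
      x , minPoly-isMin ¬Inx , trans (minPoly-at-0 x) (cong -_ x^k≡) , trans (minPoly-at-1 x) (cong -_ [x+1]^k≡)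

    ISet⇒fibre : ∀ {m} → ISet a b m → HasSize (λ x → (HasNorms ∩ ∁ In) x × minPoly x ≡ m) ℓ
    ISet⇒fibre {m} (x₀ , isMin , m[0]≡ , m[-1]≡) =
      toList (conjugates x₀ ℓ) , conjugates-unique ¬Inx₀ , (λ x → mk⇔ to from)
      , Vec.length-toList (conjugates x₀ ℓ)
      where
      ¬Inx₀ = isMin⇒¬In isMin
      m≡minPoly = isMin⇒≡minPoly isMin
      to : ∀ {x} → x ∈ toList (conjugates x₀ ℓ) → (HasNorms ∩ ∁ In) x × minPoly x ≡ m
      to {x} x∈ = ((-‿injective -x^k≡ , -‿injective -[x+1]^k≡) , conjugate⇒¬In ¬Inx₀ x∈) , minPoly≡m
        where
        minPoly≡m : minPoly x ≡ m
        minPoly≡m = trans (sym (conjugate⇒≡minPoly ¬Inx₀ x∈)) (sym m≡minPoly)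
        -x^k≡ : - (x ^ k) ≡ - (ω ^ (a ℕ.* k))
        -x^k≡ = trans (sym (minPoly-at-0 x)) (trans (cong (λ c → evalMonic c 0#) minPoly≡m) m[0]≡)
        -[x+1]^k≡ : - ((x + 1#) ^ k) ≡ - (ω ^ (b ℕ.* k))
        -[x+1]^k≡ = trans (sym (minPoly-at-1 x)) (trans (cong (λ c → evalMonic c (- 1#)) minPoly≡m) m[-1]≡)
      from : ∀ {x} → (HasNorms ∩ ∁ In) x × minPoly x ≡ m → x ∈ toList (conjugates x₀ ℓ)
      from (_ , minPoly≡m) = ≡minPoly⇒conjugate (trans minPoly≡m m≡minPoly)

    cyclotomic-number : ∀ {c t i} → a ≤ q ∸ 2 → b ≤ q ∸ 2 →
                        HasSize (CycloSet a b) c → HasSize (TSet a b) t → HasSize {Vec Carrier ℓ} (ISet a b) i →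
                        c ≡ t ℕ.+ ℓ ℕ.* i
    cyclotomic-number {c} {t} {i} a≤q∸2 b≤q∸2 C! T! I! = begin
      c              ≡⟨ hasSize-partition In? N! (hasSize-resp-⇔ TSet⇔HasNorms∩In T!) N∖F! ⟩
      t ℕ.+ _        ≡⟨ cong (t ℕ.+_) (hasSize-fibres (Vec.≡-dec _≟_) minPoly N∖F! I!
                                        (λ (Nx , ¬Inx) → HasNorms⇒ISet ¬Inx Nx) ISet⇒fibre) ⟩
      t ℕ.+ i ℕ.* ℓ  ≡⟨ cong (t ℕ.+_) (ℕ.*-comm i ℓ) ⟩
      t ℕ.+ ℓ ℕ.* i  ∎
      where
      ≤∸2⇒<∸1 : ∀ {x m} → 0 < m ∸ 1 → x ≤ m ∸ 2 → x < m ∸ 1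
      ≤∸2⇒<∸1 {m = suc (suc m)} _ x≤m = s≤s x≤m
      <e : ∀ {x} → x ≤ q ∸ 2 → x < e
      <e = ≤∸2⇒<∸1 {m = q} 0<q∸1
      N! : HasSize HasNorms c
      N! = hasSize-resp-⇔ (CycloSet⇔HasNorms (<e a≤q∸2) (<e b≤q∸2)) C!
      N∖F! = hasSize-∩ (∁? In?) N!

open import Data.Nat using (_+_; _*_; _^_; _∸_; _≤_)
open import Data.Vec using (Vec)

proposition5p1 :
    (p n ℓ : ℕ) → Prime p → 1 ≤ n → Prime ℓ → ℓ ≢ 2 →
    (K : Field) → (F : Subfield K) →
    HasSize {Field.Carrier K} (λ _ → ⊤) ((p ^ n) ^ ℓ) →
    HasSize (Subfield.In F) (p ^ n) →
    (ω : Field.Carrier K) →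
    (∀ x → x ≢ Field.0# K → Σ ℕ (λ i → Field._^_ K ω i ≡ x)) →
    (k : ℕ) → k * (p ^ n ∸ 1) ≡ (p ^ n) ^ ℓ ∸ 1 →
    (a b : ℕ) → a ≤ p ^ n ∸ 2 → b ≤ p ^ n ∸ 2 →
    (c t i : ℕ) →
    HasSize (Cyclotomy.CycloSet K F ω (p ^ n ∸ 1) k ℓ a b) c →
    HasSize (Cyclotomy.TSet K F ω (p ^ n ∸ 1) k ℓ a b) t →
    HasSize {Vec (Field.Carrier K) ℓ} (Cyclotomy.ISet K F ω (p ^ n ∸ 1) k ℓ a b) i →
    c ≡ t + ℓ * i
proposition5p1 p n ℓ p-prime _ ℓ-prime ℓ≢2 K F K! F! ω ω-generates k k*e≡Q∸1 a b a≤q∸2 b≤q∸2 c t i =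
  cyclotomic-number a b a≤q∸2 b≤q∸2
  where
  open CyclotomicNumbers K F {n = n} p-prime ℓ-prime ℓ≢2 K! F! ω ω-generates {k} k*e≡Q∸1
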